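{- Let $a,b$ be positive integers and $i$ an integer with $1\le i\le b$. Then for every $j \in \{ 0, 1, \ldots, i-1 \}$, \[ K^{\mathfrak{L}}_{(a+i,b-i), (a+j,b-j)} = T(a+i,i-j), \] where $T(n,k) := \frac{1}{n}\sum_{d \mid n,\ d\mid k} \varphi(d) \binom{n/d}{k/d}$ (the number of necklaces with $k$ black beads and $n-k$ white beads), $\varphi$ being Euler's totient function.
   Context: Convention: a tuple with a trailing zero part, such as $(a+b,0)$, is identified with the composition obtained by deleting it. A composition is a tuple of positive integers; its diagram has left-justified rows, row $i$ (from the bottom) with $\alpha_i$ cells. A word is a necklace word if it is lexicographically weakly smallest among its cyclic shifts. A lexical tableau of shape $\alpha$ and type $\beta$ is a filling of the diagram of $\alpha$ with positive integers in which $m$ appears $\beta_m$ times, the first column strictly increases from the bottom row upward, and every row read left to right is a necklace word; $K^{\mathfrak{L}}_{\alpha,\beta}$ is their number. -}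

module Defs where

open import Data.Nat using (ℕ; zero; suc; _+_; _*_; _∸_; _/_; _≤_; _<_; _≟_; _≤?_; _<?_)
open import Data.Nat.GCD using (gcd)
open import Data.Nat.Divisibility using (_∣_; _∣?_)
open import Data.Nat.Combinatorics using (_C_)
open import Data.Product using (_×_; _,_)
open import Data.Product.Properties using ()
open import Data.Maybe using (Maybe)
open import Data.List using (List; []; _∷_; length; filter; map; concat; concatMap;
  applyUpTo; mapMaybe; head; drop; take; _++_)
open import Data.Nat.ListAction using (sum)
open import Data.List.Relation.Unary.All using (All; all?)
open import Data.List.Relation.Unary.Linked using (Linked; linked?)
open import Data.List.Relation.Binary.Pointwise using (Pointwise)
import Data.List.Relation.Binary.Pointwise.Properties as PwP
open import Data.List.Relation.Binary.Lex.NonStrict using (Lex-≤; ≤-decidable)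
open import Relation.Binary.PropositionalEquality using (_≡_)
open import Relation.Nullary using (Dec; yes; no)
open import Relation.Nullary.Decidable using (_×-dec_)

Word : Set
Word = List ℕ

_≤lex_ : Word → Word → Set
_≤lex_ = Lex-≤ _≡_ _≤_

_≤lex?_ : (u v : Word) → Dec (u ≤lex v)
_≤lex?_ = ≤-decidable _≟_ _≤?_

rotate : ℕ → Word → Word
rotate k w = drop k w ++ take k w

rotations : Word → List Word
rotations w = applyUpTo (λ k → rotate k w) (length w)

IsNecklace : Word → Set
IsNecklace w = All (λ v → w ≤lex v) (rotations w)

isNecklace? : (w : Word) → Dec (IsNecklace w)
isNecklace? w = all? (λ v → w ≤lex? v) (rotations w)

-- A composition is a list of positive integers α = (α₁, α₂, …);
-- a filling of its diagram is the list of its rows, bottom row first.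
Composition : Set
Composition = List ℕ

Filling : Set
Filling = List Word

-- the two-part tuple (x , y), identified with (x) when y = 0
comp2 : ℕ → ℕ → Composition
comp2 x zero    = x ∷ []
comp2 x (suc y) = x ∷ suc y ∷ []

occ : ℕ → Word → ℕ
occ m w = length (filter (λ x → m ≟ x) w)

firstColumn : Filling → List ℕ
firstColumn F = mapMaybe head F

-- T is a lexical tableau of shape α and type β:
--  * row i has α_i cells;
--  * every entry is a positive integer ≤ ℓ(β) (a value m > ℓ(β) has β_m = 0);
--  * for m = 1..ℓ(β), m appears exactly β_m times;
--  * the first column strictly increases from the bottom row upward;
--  * every row is a necklace word.
IsLexTableau : Composition → Composition → Filling → Set
IsLexTableau α β F =
    Pointwise (λ row n → length row ≡ n) F α
  × All (All (λ x → 1 ≤ x × x ≤ length β)) F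
  × Pointwise (λ m b → occ m (concat F) ≡ b) (applyUpTo suc (length β)) β
  × Linked _<_ (firstColumn F)
  × All IsNecklace F

isLexTableau? : (α β : Composition) (F : Filling) → Dec (IsLexTableau α β F)
isLexTableau? α β F =
      PwP.decidable (λ row n → length row ≟ n) F α
  ×-dec all? (all? (λ x → (1 ≤? x) ×-dec (x ≤? length β))) F
  ×-dec PwP.decidable (λ m b → occ m (concat F) ≟ b) (applyUpTo suc (length β)) β
  ×-dec linked? _<?_ (firstColumn F)
  ×-dec all? isNecklace? F

wordsOver : ℕ → ℕ → List Word
wordsOver k zero    = [] ∷ []
wordsOver k (suc n) =
  concatMap (λ x → map (x ∷_) (wordsOver k n)) (applyUpTo suc k)

fillings : Composition → ℕ → List Filling
fillings []      k = [] ∷ []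
fillings (n ∷ α) k =
  concatMap (λ r → map (r ∷_) (fillings α k)) (wordsOver k n)

-- K^L_{α,β}: number of lexical tableaux of shape α and type β.
-- (Every lexical tableau has entries in {1..ℓ(β)}, so it occurs exactly
--  once in fillings α (length β).)
KL : Composition → Composition → ℕ
KL α β = length (filter (isLexTableau? α β) (fillings α (length β)))

totient : ℕ → ℕ
totient d = length (filter (λ t → gcd t d ≟ 1) (applyUpTo suc d))

-- summand for the divisor d = suc e
necklaceTerm : ℕ → ℕ → ℕ → ℕ
necklaceTerm n k e with suc e ∣? n | suc e ∣? k
... | yes _ | yes _ = totient (suc e) * ((n / suc e) C (k / suc e))
... | _         | _         = 0

T : ℕ → ℕ → ℕ
T zero    k = 0
T (suc n) k = sum (applyUpTo (necklaceTerm (suc n) k) (suc n)) / suc n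

-- A lexical tableau of shape (a+i, b−i) and type (a+j, b−j) is filled with the letters 1 and 2.
-- If it has a top row, its first letter exceeds that of the bottom row, so it is 2, and a necklace
-- word starting with its largest letter is constant: the top row is 2 2 … 2. The bottom row is then
-- an arbitrary binary necklace word of length n = a+i with k = i−j letters 2 (it contains the
-- a+j ≥ 1 letters 1, so it starts with 1). The necklace rotations of a word all coincide, so a word
-- has as many rotations that are necklace words as rotations fixing it; summing over all words
-- gives Burnside's count n · K = Σ_{s<n} #{w : rotate s w ≡ w}. By Lyndon–Schützenberger the words
-- fixed by rotation by s are the (n/g)-th powers of the words of length g = gcd(s, n), with k letters
-- 2 in C(g, k g/n) of them if n/g divides k, and exactly φ(d) rotations s < n have n/gcd(s, n) = d.

module Submission where

open import Defs
open import Data.Empty using (⊥-elim)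
open import Data.List
  using (List; []; _∷_; length; filter; map; concatMap; applyUpTo; upTo; drop; take; _++_; replicate)
open import Data.List.Membership.Propositional using (_∈_; _∉_)
open import Data.List.Membership.Propositional.Properties
  using (∈-map⁺; ∈-map⁻; ∈-++⁺ˡ; ∈-++⁺ʳ; ∈-++⁻; ∈-filter⁺; ∈-filter⁻)
open import Data.List.Properties
  using (map-upTo; ∷-injectiveʳ; length-++; filter-++; filter-reject; take++drop≡id; drop-drop; take-all; drop-all;
         take-take; length-take; ++-identityʳ; ++-assoc; ++-cancelˡ; length-drop; length-replicate; ≡-dec)
open import Data.List.Relation.Binary.Lex.Core using (this; next)
import Data.List.Relation.Binary.Lex.NonStrict as Lex
open import Data.List.Relation.Binary.Pointwise using (Pointwise-≡⇒≡; ≡⇒Pointwise-≡; []; _∷_)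
open import Data.List.Relation.Unary.All using (All; []; _∷_) renaming (lookup to lookupAll; tabulate to tabulateAll)
open import Data.List.Relation.Unary.All.Properties using (applyUpTo⁻; applyUpTo⁺₁; ++⁺; ++⁻ˡ; drop⁺; take⁺; replicate⁺)
open import Data.List.Relation.Unary.AllPairs using ([]; _∷_)
open import Data.List.Relation.Unary.Any using (here; there)
open import Data.List.Relation.Unary.Linked using (Linked; []; [-]; _∷_)
open import Data.List.Relation.Unary.Unique.Propositional using (Unique)
open import Data.List.Relation.Unary.Unique.Propositional.Properties using (map⁺; filter⁺) renaming (++⁺ to Unique-++⁺)
open import Data.Nat using (ℕ; zero; suc; _+_; _*_; _∸_; _/_; _≤_; _<_; z≤n; s≤s; z<s; s<s; s≤s⁻¹; NonZero; >-nonZero⁻¹; _≟_; _≤?_; _<?_)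
open import Data.Nat.Combinatorics using (_C_; nCk+nC[k+1]≡[n+1]C[k+1])
open import Data.Nat.Divisibility using (_∣_; _∣?_; divides; ∣-antisym; ∣-refl; ∣m∸n∣n⇒∣m; ∣m+n∣m⇒∣n; n∣m*n; ∣⇒≤)
open import Data.Nat.DivMod using (m*n/n≡m; m/n*n≡m; m*[n/m]≡n)
open import Data.Nat.GCD
  using (gcd; gcd[m,n]∣m; gcd[m,n]∣n; gcd-greatest; gcd-comm; gcd-identityˡ; gcd[m,n]≡0⇒n≡0; c*gcd[m,n]≡gcd[cm,cn])
open import Data.Nat.ListAction using (sum)
open import Data.Nat.Properties
open import Algebra.Properties.CommutativeSemigroup +-commutativeSemigroup using (interchange)
open import Data.Product using (_×_; _,_; proj₁; proj₂; ∃-syntax)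
open import Data.Sum using (_⊎_; inj₁; inj₂)
open import Relation.Binary.Definitions using (DecidableEquality)
open import Relation.Nullary using (Dec; yes; no; ¬_; _×-dec_)
open import Relation.Binary.PropositionalEquality

private
  variable
    A B P Q : Set

𝟙 : Dec P → ℕ
𝟙 (yes _) = 1
𝟙 (no _)  = 0

𝟙-⇔ : (P → Q) → (Q → P) → (p : Dec P) (q : Dec Q) → 𝟙 p ≡ 𝟙 q
𝟙-⇔ f g (yes _) (yes _) = refl
𝟙-⇔ f g (yes p) (no ¬q) = ⊥-elim (¬q (f p))
𝟙-⇔ f g (no ¬p) (yes q) = ⊥-elim (¬p (g q))
𝟙-⇔ f g (no _)  (no _)  = refl

𝟙-no : ¬ P → (p : Dec P) → 𝟙 p ≡ 0
𝟙-no ¬p (yes p) = ⊥-elim (¬p p)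
𝟙-no ¬p (no _)  = refl

𝟙-× : (p : Dec P) (q : Dec Q) → 𝟙 (p ×-dec q) ≡ 𝟙 p * 𝟙 q
𝟙-× (yes _) (yes _) = refl
𝟙-× (yes _) (no _)  = refl
𝟙-× (no _)  _       = refl

𝟙-suc : ∀ m n → 𝟙 (suc m ≟ suc n) ≡ 𝟙 (m ≟ n)
𝟙-suc m n = 𝟙-⇔ suc-injective (cong suc) (suc m ≟ suc n) (m ≟ n)

∑ : List A → (A → ℕ) → ℕ
∑ []       f = 0
∑ (x ∷ xs) f = f x + ∑ xs f

∑-++ : ∀ (xs ys : List A) f → ∑ (xs ++ ys) f ≡ ∑ xs f + ∑ ys f
∑-++ []       ys f = refl
∑-++ (x ∷ xs) ys f = trans (cong (f x +_) (∑-++ xs ys f)) (sym (+-assoc (f x) _ _))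

∑-map : ∀ (g : A → B) xs f → ∑ (map g xs) f ≡ ∑ xs (λ x → f (g x))
∑-map g []       f = refl
∑-map g (x ∷ xs) f = cong (f (g x) +_) (∑-map g xs f)

∑-concatMap : ∀ (g : A → List B) xs f → ∑ (concatMap g xs) f ≡ ∑ xs (λ x → ∑ (g x) f)
∑-concatMap g []       f = refl
∑-concatMap g (x ∷ xs) f = trans (∑-++ (g x) (concatMap g xs) f) (cong (∑ (g x) f +_) (∑-concatMap g xs f))

∑-cong-∈ : ∀ (xs : List A) {f g : A → ℕ} → (∀ x → x ∈ xs → f x ≡ g x) → ∑ xs f ≡ ∑ xs g
∑-cong-∈ []       eq = refl
∑-cong-∈ (x ∷ xs) eq = cong₂ _+_ (eq x (here refl)) (∑-cong-∈ xs (λ y y∈ → eq y (there y∈)))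

∑-cong : ∀ (xs : List A) {f g : A → ℕ} → (∀ x → f x ≡ g x) → ∑ xs f ≡ ∑ xs g
∑-cong xs eq = ∑-cong-∈ xs (λ x _ → eq x)

∑-zero : ∀ (xs : List A) → ∑ xs (λ _ → 0) ≡ 0
∑-zero []       = refl
∑-zero (x ∷ xs) = ∑-zero xs

∑-+ : ∀ (xs : List A) f g → ∑ xs (λ x → f x + g x) ≡ ∑ xs f + ∑ xs g
∑-+ []       f g = refl
∑-+ (x ∷ xs) f g = trans (cong (f x + g x +_) (∑-+ xs f g)) (interchange (f x) (g x) _ _)

∑-*ˡ : ∀ (xs : List A) c f → ∑ xs (λ x → c * f x) ≡ c * ∑ xs f
∑-*ˡ []       c f = sym (*-zeroʳ c)
∑-*ˡ (x ∷ xs) c f = trans (cong (c * f x +_) (∑-*ˡ xs c f)) (sym (*-distribˡ-+ c (f x) _))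

∑-*ʳ : ∀ (xs : List A) c f → ∑ xs (λ x → f x * c) ≡ ∑ xs f * c
∑-*ʳ xs c f = trans (∑-cong xs (λ x → *-comm (f x) c)) (trans (∑-*ˡ xs c f) (*-comm c _))

∑-comm : ∀ (xs : List A) (ys : List B) (f : A → B → ℕ) → ∑ xs (λ x → ∑ ys (f x)) ≡ ∑ ys (λ y → ∑ xs (λ x → f x y))
∑-comm []       ys f = sym (∑-zero ys)
∑-comm (x ∷ xs) ys f =
  trans (cong (∑ ys (f x) +_) (∑-comm xs ys f)) (sym (∑-+ ys (f x) (λ y → ∑ xs (λ x′ → f x′ y))))

length-filter≡∑𝟙 : ∀ {P : A → Set} (P? : ∀ x → Dec (P x)) xs → length (filter P? xs) ≡ ∑ xs (λ x → 𝟙 (P? x))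
length-filter≡∑𝟙 P? []       = refl
length-filter≡∑𝟙 P? (x ∷ xs) with P? x
... | yes _ = cong suc (length-filter≡∑𝟙 P? xs)
... | no _  = length-filter≡∑𝟙 P? xs

∑-filter : ∀ {P : A → Set} (P? : ∀ x → Dec (P x)) xs f → ∑ (filter P? xs) f ≡ ∑ xs (λ x → 𝟙 (P? x) * f x)
∑-filter P? []       f = refl
∑-filter P? (x ∷ xs) f with P? x
... | yes _ = cong₂ _+_ (sym (+-identityʳ (f x))) (∑-filter P? xs f)
... | no _  = ∑-filter P? xs f

module _ (_≟ᴬ_ : DecidableEquality A) where

  ∑-𝟙≡-∉ : ∀ xs {y} → y ∉ xs → ∑ xs (λ x → 𝟙 (x ≟ᴬ y)) ≡ 0
  ∑-𝟙≡-∉ []       y∉ = refl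
  ∑-𝟙≡-∉ (x ∷ xs) {y} y∉ with x ≟ᴬ y
  ... | yes refl = ⊥-elim (y∉ (here refl))
  ... | no _     = ∑-𝟙≡-∉ xs (λ y∈ → y∉ (there y∈))

  ∑-𝟙≡-∈ : ∀ {xs} → Unique xs → ∀ {y} → y ∈ xs → ∑ xs (λ x → 𝟙 (x ≟ᴬ y)) ≡ 1
  ∑-𝟙≡-∈ {x ∷ xs} (x∉ ∷ _) (here refl) with x ≟ᴬ x
  ... | yes _  = cong suc (∑-𝟙≡-∉ xs (λ x∈ → lookupAll x∉ x∈ refl))
  ... | no x≢x = ⊥-elim (x≢x refl)
  ∑-𝟙≡-∈ {x ∷ xs} (x∉ ∷ u) {y} (there y∈) with x ≟ᴬ y
  ... | yes refl = ⊥-elim (lookupAll x∉ y∈ refl)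
  ... | no _     = ∑-𝟙≡-∈ u y∈

  -- Both sums equal the double sum of h y over the pairs x ≡ y.
  ∑-reindex : ∀ {xs ys} → Unique xs → Unique ys → (∀ y → y ∈ ys → y ∈ xs) → (∀ x → x ∈ xs → x ∈ ys) →
              ∀ h → ∑ xs h ≡ ∑ ys h
  ∑-reindex {xs} {ys} uxs uys ys⊆xs xs⊆ys h = begin
    ∑ xs h                                      ≡⟨ ∑-cong-∈ xs (λ x x∈ → sym (collapse uys (xs⊆ys x x∈))) ⟩
    ∑ xs (λ x → ∑ ys (λ y → 𝟙 (y ≟ᴬ x) * h x))  ≡⟨ ∑-cong xs (λ x → ∑-cong ys (λ y → 𝟙-≟-sym y x)) ⟩
    ∑ xs (λ x → ∑ ys (λ y → 𝟙 (x ≟ᴬ y) * h y))  ≡⟨ ∑-comm xs ys _ ⟩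
    ∑ ys (λ y → ∑ xs (λ x → 𝟙 (x ≟ᴬ y) * h y))  ≡⟨ ∑-cong-∈ ys (λ y y∈ → collapse uxs (ys⊆xs y y∈)) ⟩
    ∑ ys h                                      ∎
    where
    open ≡-Reasoning
    collapse : ∀ {zs} → Unique zs → ∀ {y} → y ∈ zs → ∑ zs (λ x → 𝟙 (x ≟ᴬ y) * h y) ≡ h y
    collapse {zs} u {y} y∈ = trans (∑-*ʳ zs (h y) _) (trans (cong (_* h y) (∑-𝟙≡-∈ u y∈)) (+-identityʳ (h y)))
    𝟙-≟-sym : ∀ x y → 𝟙 (x ≟ᴬ y) * h y ≡ 𝟙 (y ≟ᴬ x) * h x
    𝟙-≟-sym x y with x ≟ᴬ y | y ≟ᴬ x
    ... | yes refl | yes _    = refl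
    ... | yes refl | no y≢y   = ⊥-elim (y≢y refl)
    ... | no x≢x   | yes refl = ⊥-elim (x≢x refl)
    ... | no _     | no _     = refl

∑< : ℕ → (ℕ → ℕ) → ℕ
∑< n f = ∑ (upTo n) f

∑-applyUpTo : ∀ (g : ℕ → A) n f → ∑ (applyUpTo g n) f ≡ ∑< n (λ i → f (g i))
∑-applyUpTo g n f = trans (cong (λ l → ∑ l f) (sym (map-upTo g n))) (∑-map g (upTo n) f)

sum-applyUpTo : ∀ (f : ℕ → ℕ) n → sum (applyUpTo f n) ≡ ∑< n f
sum-applyUpTo f n = trans (sum≡∑ (applyUpTo f n)) (∑-applyUpTo f n (λ x → x))
  where
  sum≡∑ : ∀ xs → sum xs ≡ ∑ xs (λ x → x)
  sum≡∑ []       = refl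
  sum≡∑ (x ∷ xs) = cong (x +_) (sum≡∑ xs)

∑<-suc : ∀ n f → ∑< (suc n) f ≡ f 0 + ∑< n (λ i → f (suc i))
∑<-suc n f = cong (f 0 +_) (∑-applyUpTo suc n f)

∑<-cong : ∀ n {f g} → (∀ i → f i ≡ g i) → ∑< n f ≡ ∑< n g
∑<-cong n = ∑-cong (upTo n)

∑<-cong-< : ∀ n {f g} → (∀ i → i < n → f i ≡ g i) → ∑< n f ≡ ∑< n g
∑<-cong-< zero    eq = refl
∑<-cong-< (suc n) {f} {g} eq = begin
  ∑< (suc n) f                   ≡⟨ ∑<-suc n f ⟩
  f 0 + ∑< n (λ i → f (suc i))   ≡⟨ cong₂ _+_ (eq 0 z<s) (∑<-cong-< n (λ i i<n → eq (suc i) (s<s i<n))) ⟩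
  g 0 + ∑< n (λ i → g (suc i))   ≡⟨ sym (∑<-suc n g) ⟩
  ∑< (suc n) g                   ∎
  where open ≡-Reasoning

∑<-zero : ∀ n {f} → (∀ i → i < n → f i ≡ 0) → ∑< n f ≡ 0
∑<-zero n eq = trans (∑<-cong-< n eq) (∑-zero (upTo n))

∑<-const : ∀ n c → ∑< n (λ _ → c) ≡ n * c
∑<-const zero    c = refl
∑<-const (suc n) c = trans (∑<-suc n (λ _ → c)) (cong (c +_) (∑<-const n c))

∑<-+ : ∀ m n f → ∑< (m + n) f ≡ ∑< m f + ∑< n (λ i → f (m + i))
∑<-+ zero    n f = refl
∑<-+ (suc m) n f = begin
  ∑< (suc (m + n)) f
    ≡⟨ ∑<-suc (m + n) f ⟩
  f 0 + ∑< (m + n) (λ i → f (suc i))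
    ≡⟨ cong (f 0 +_) (∑<-+ m n (λ i → f (suc i))) ⟩
  f 0 + (∑< m (λ i → f (suc i)) + ∑< n (λ i → f (suc (m + i))))
    ≡⟨ sym (+-assoc (f 0) _ _) ⟩
  f 0 + ∑< m (λ i → f (suc i)) + ∑< n (λ i → f (suc (m + i)))
    ≡⟨ cong (_+ ∑< n (λ i → f (suc (m + i)))) (sym (∑<-suc m f)) ⟩
  ∑< (suc m) f + ∑< n (λ i → f (suc m + i)) ∎
  where open ≡-Reasoning

∑<-sucʳ : ∀ n f → ∑< (suc n) f ≡ ∑< n f + f n
∑<-sucʳ n f = begin
  ∑< (suc n) f               ≡⟨ cong (λ m → ∑< m f) (+-comm 1 n) ⟩
  ∑< (n + 1) f               ≡⟨ ∑<-+ n 1 f ⟩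
  ∑< n f + (f (n + 0) + 0)   ≡⟨ cong (∑< n f +_) (trans (+-identityʳ _) (cong f (+-identityʳ n))) ⟩
  ∑< n f + f n               ∎
  where open ≡-Reasoning

∑<-* : ∀ d g f → ∑< (d * g) f ≡ ∑< d (λ t → ∑< g (λ r → f (t * g + r)))
∑<-* zero    g f = refl
∑<-* (suc d) g f = begin
  ∑< (g + d * g) f
    ≡⟨ ∑<-+ g (d * g) f ⟩
  ∑< g f + ∑< (d * g) (λ i → f (g + i))
    ≡⟨ cong (∑< g f +_) (∑<-* d g (λ i → f (g + i))) ⟩
  ∑< g f + ∑< d (λ t → ∑< g (λ r → f (g + (t * g + r))))
    ≡⟨ cong (∑< g f +_) (∑<-cong d (λ t → ∑<-cong g (λ r → cong f (sym (+-assoc g (t * g) r))))) ⟩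
  ∑< g f + ∑< d (λ t → ∑< g (λ r → f (suc t * g + r)))
    ≡⟨ sym (∑<-suc d (λ t → ∑< g (λ r → f (t * g + r)))) ⟩
  ∑< (suc d) (λ t → ∑< g (λ r → f (t * g + r))) ∎
  where open ≡-Reasoning

∑<-select : ∀ n u (G : ℕ → ℕ) → u < n → ∑< n (λ e → 𝟙 (suc u ≟ suc e) * G e) ≡ G u
∑<-select (suc n) zero G _ = begin
  ∑< (suc n) (λ e → 𝟙 (1 ≟ suc e) * G e)
    ≡⟨ ∑<-suc n (λ e → 𝟙 (1 ≟ suc e) * G e) ⟩
  G 0 + 0 + ∑< n (λ e → 𝟙 (1 ≟ suc (suc e)) * G (suc e))
    ≡⟨ cong₂ _+_ (+-identityʳ (G 0)) (∑<-zero n (λ e _ → cong (_* G (suc e)) (𝟙-no (λ ()) (1 ≟ suc (suc e))))) ⟩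
  G 0 + 0
    ≡⟨ +-identityʳ (G 0) ⟩
  G 0 ∎
  where open ≡-Reasoning
∑<-select (suc n) (suc u) G (s<s u<n) = begin
  ∑< (suc n) (λ e → 𝟙 (suc (suc u) ≟ suc e) * G e)
    ≡⟨ ∑<-suc n (λ e → 𝟙 (suc (suc u) ≟ suc e) * G e) ⟩
  𝟙 (suc (suc u) ≟ 1) * G 0 + ∑< n (λ e → 𝟙 (suc (suc u) ≟ suc (suc e)) * G (suc e))
    ≡⟨ cong₂ _+_ (cong (_* G 0) (𝟙-no (λ ()) (suc (suc u) ≟ 1))) (∑<-cong n (λ e → cong (_* G (suc e)) (𝟙-suc (suc u) (suc e)))) ⟩
  ∑< n (λ e → 𝟙 (suc u ≟ suc e) * G (suc e))
    ≡⟨ ∑<-select n u (λ e → G (suc e)) u<n ⟩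
  G (suc u) ∎
  where open ≡-Reasoning

Binary : ℕ → Set
Binary x = 1 ≤ x × x ≤ 2

binary-cases : ∀ {x} → Binary x → x ≡ 1 ⊎ x ≡ 2
binary-cases (s≤s z≤n , s≤s z≤n)       = inj₁ refl
binary-cases (s≤s z≤n , s≤s (s≤s z≤n)) = inj₂ refl

binaryWords : ℕ → List Word
binaryWords = wordsOver 2

binaryWords-sound : ∀ n {w} → w ∈ binaryWords n → length w ≡ n × All Binary w
binaryWords-sound zero    (here refl) = refl , []
binaryWords-sound (suc n) w∈ with ∈-++⁻ (map (1 ∷_) (binaryWords n)) w∈
... | inj₁ w∈₁ with ∈-map⁻ (1 ∷_) w∈₁
...   | v , v∈ , refl = cong suc (proj₁ (binaryWords-sound n v∈)) , (≤-refl , s≤s z≤n) ∷ proj₂ (binaryWords-sound n v∈)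
binaryWords-sound (suc n) w∈ | inj₂ w∈₂ with ∈-++⁻ (map (2 ∷_) (binaryWords n)) w∈₂
... | inj₂ ()
... | inj₁ w∈₂′ with ∈-map⁻ (2 ∷_) w∈₂′
...   | v , v∈ , refl = cong suc (proj₁ (binaryWords-sound n v∈)) , (s≤s z≤n , ≤-refl) ∷ proj₂ (binaryWords-sound n v∈)

binaryWords-complete : ∀ {n w} → length w ≡ n → All Binary w → w ∈ binaryWords n
binaryWords-complete {w = []}    refl []       = here refl
binaryWords-complete {w = x ∷ w} refl (b ∷ bs) with binary-cases b
... | inj₁ refl = ∈-++⁺ˡ (∈-map⁺ (1 ∷_) (binaryWords-complete refl bs))
... | inj₂ refl = ∈-++⁺ʳ (map (1 ∷_) (binaryWords (length w))) (∈-++⁺ˡ (∈-map⁺ (2 ∷_) (binaryWords-complete refl bs)))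

binaryWords-unique : ∀ n → Unique (binaryWords n)
binaryWords-unique zero    = [] ∷ []
binaryWords-unique (suc n) =
  Unique-++⁺ (map⁺ ∷-injectiveʳ (binaryWords-unique n))
             (Unique-++⁺ (map⁺ ∷-injectiveʳ (binaryWords-unique n)) [] (λ { (_ , ()) }))
             disjoint
  where
  disjoint : ∀ {v} → ¬ (v ∈ map (1 ∷_) (binaryWords n) × v ∈ map (2 ∷_) (binaryWords n) ++ [])
  disjoint (v∈₁ , v∈₂) with ∈-map⁻ (1 ∷_) v∈₁ | ∈-++⁻ (map (2 ∷_) (binaryWords n)) v∈₂
  ... | _ , _ , refl | inj₂ ()
  ... | _ , _ , refl | inj₁ v∈₂′ with ∈-map⁻ (2 ∷_) v∈₂′
  ...   | _ , _ , ()

_≟ʷ_ : DecidableEquality Word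
_≟ʷ_ = ≡-dec _≟_

occ-++ : ∀ m xs ys → occ m (xs ++ ys) ≡ occ m xs + occ m ys
occ-++ m xs ys = trans (cong length (filter-++ (m ≟_) xs ys)) (length-++ (filter (m ≟_) xs))

occ₁+occ₂≡length : ∀ {w} → All Binary w → occ 1 w + occ 2 w ≡ length w
occ₁+occ₂≡length {[]}    []       = refl
occ₁+occ₂≡length {x ∷ w} (b ∷ bs) with binary-cases b
... | inj₁ refl = cong suc (occ₁+occ₂≡length bs)
... | inj₂ refl = trans (+-suc (occ 1 w) (occ 2 w)) (cong suc (occ₁+occ₂≡length bs))

occ>0⇒∈ : ∀ x (w : Word) → 0 < occ x w → x ∈ w
occ>0⇒∈ x (y ∷ w) occ>0 with x ≟ y
... | yes refl = here refl
... | no x≢y   = there (occ>0⇒∈ x w (subst (0 <_) (cong length (filter-reject (x ≟_) x≢y)) occ>0))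

∑-binaryWords-occ₂ : ∀ n k → ∑ (binaryWords n) (λ w → 𝟙 (occ 2 w ≟ k)) ≡ n C k
∑-binaryWords-occ₂ zero    zero    = refl
∑-binaryWords-occ₂ zero    (suc k) = refl
∑-binaryWords-occ₂ (suc n) k = begin
  ∑ (map (1 ∷_) (binaryWords n) ++ (map (2 ∷_) (binaryWords n) ++ [])) f
    ≡⟨ ∑-++ (map (1 ∷_) (binaryWords n)) _ f ⟩
  ∑ (map (1 ∷_) (binaryWords n)) f + ∑ (map (2 ∷_) (binaryWords n) ++ []) f
    ≡⟨ cong₂ _+_ (∑-map (1 ∷_) (binaryWords n) f)
                 (trans (cong (λ l → ∑ l f) (++-identityʳ (map (2 ∷_) (binaryWords n)))) (∑-map (2 ∷_) (binaryWords n) f)) ⟩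
  ∑ (binaryWords n) f + ∑ (binaryWords n) (λ w → 𝟙 (suc (occ 2 w) ≟ k))
    ≡⟨ cong (_+ ∑ (binaryWords n) (λ w → 𝟙 (suc (occ 2 w) ≟ k))) (∑-binaryWords-occ₂ n k) ⟩
  n C k + ∑ (binaryWords n) (λ w → 𝟙 (suc (occ 2 w) ≟ k))
    ≡⟨ pascal k ⟩
  suc n C k ∎
  where
  open ≡-Reasoning
  f : Word → ℕ
  f w = 𝟙 (occ 2 w ≟ k)
  pascal : ∀ k → n C k + ∑ (binaryWords n) (λ w → 𝟙 (suc (occ 2 w) ≟ k)) ≡ suc n C k
  pascal zero    = cong (n C 0 +_) (∑-zero (binaryWords n))
  pascal (suc k) = begin
    n C suc k + ∑ (binaryWords n) (λ w → 𝟙 (suc (occ 2 w) ≟ suc k))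
      ≡⟨ cong (n C suc k +_) (trans (∑-cong (binaryWords n) (λ w → 𝟙-suc (occ 2 w) k)) (∑-binaryWords-occ₂ n k)) ⟩
    n C suc k + n C k
      ≡⟨ +-comm (n C suc k) (n C k) ⟩
    n C k + n C suc k
      ≡⟨ nCk+nC[k+1]≡[n+1]C[k+1] n k ⟩
    suc n C suc k ∎

drop-++ˡ : ∀ k (xs ys : Word) → k ≤ length xs → drop k (xs ++ ys) ≡ drop k xs ++ ys
drop-++ˡ zero    xs       ys _         = refl
drop-++ˡ (suc k) (x ∷ xs) ys (s≤s k≤) = drop-++ˡ k xs ys k≤

take-++ˡ : ∀ k (xs ys : Word) → k ≤ length xs → take k (xs ++ ys) ≡ take k xs
take-++ˡ zero    xs       ys _         = refl
take-++ˡ (suc k) (x ∷ xs) ys (s≤s k≤) = cong (x ∷_) (take-++ˡ k xs ys k≤)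

drop-++ʳ : ∀ j (xs ys : Word) → drop (length xs + j) (xs ++ ys) ≡ drop j ys
drop-++ʳ j []       ys = refl
drop-++ʳ j (x ∷ xs) ys = drop-++ʳ j xs ys

take-++ʳ : ∀ j (xs ys : Word) → take (length xs + j) (xs ++ ys) ≡ xs ++ take j ys
take-++ʳ j []       ys = refl
take-++ʳ j (x ∷ xs) ys = cong (x ∷_) (take-++ʳ j xs ys)

take-length-++ : ∀ (xs ys : Word) → take (length xs) (xs ++ ys) ≡ xs
take-length-++ []       ys = refl
take-length-++ (x ∷ xs) ys = cong (x ∷_) (take-length-++ xs ys)

drop-length-++ : ∀ (xs ys : Word) → drop (length xs) (xs ++ ys) ≡ ys
drop-length-++ []       ys = refl
drop-length-++ (x ∷ xs) ys = drop-length-++ xs ys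

take-+ : ∀ m n (w : Word) → take (m + n) w ≡ take m w ++ take n (drop m w)
take-+ zero    n w       = refl
take-+ (suc m) zero    [] = refl
take-+ (suc m) (suc n) [] = refl
take-+ (suc m) n (x ∷ w) = cong (x ∷_) (take-+ m n w)

take-take≤ : ∀ {m n} (w : Word) → m ≤ n → take m (take n w) ≡ take m w
take-take≤ {m} {n} w m≤n = trans (take-take m n w) (cong (λ k → take k w) (m≤n⇒m⊓n≡m m≤n))

length-take≤ : ∀ {k} (w : Word) → k ≤ length w → length (take k w) ≡ k
length-take≤ {k} w k≤ = trans (length-take k w) (m≤n⇒m⊓n≡m k≤)

All≡⇒≡replicate : ∀ {y} {w : Word} → All (_≡ y) w → w ≡ replicate (length w) y
All≡⇒≡replicate []          = refl
All≡⇒≡replicate (refl ∷ as) = cong (_ ∷_) (All≡⇒≡replicate as)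

∈⇒drop≡∷ : ∀ {y} {w : Word} → y ∈ w → ∃[ k ] (k < length w × ∃[ rest ] (drop k w ≡ y ∷ rest))
∈⇒drop≡∷ {w = _ ∷ w} (here refl) = 0 , z<s , w , refl
∈⇒drop≡∷ (there y∈) with ∈⇒drop≡∷ y∈
... | k , k< , rest , eq = suc k , s<s k< , rest , eq

length-rotate : ∀ k w → length (rotate k w) ≡ length w
length-rotate k w = begin
  length (drop k w ++ take k w)           ≡⟨ length-++ (drop k w) ⟩
  length (drop k w) + length (take k w)   ≡⟨ +-comm (length (drop k w)) _ ⟩
  length (take k w) + length (drop k w)   ≡⟨ sym (length-++ (take k w)) ⟩
  length (take k w ++ drop k w)           ≡⟨ cong length (take++drop≡id k w) ⟩
  length w                                ∎
  where open ≡-Reasoning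

occ-rotate : ∀ m k w → occ m (rotate k w) ≡ occ m w
occ-rotate m k w = begin
  occ m (drop k w ++ take k w)            ≡⟨ occ-++ m (drop k w) (take k w) ⟩
  occ m (drop k w) + occ m (take k w)     ≡⟨ +-comm (occ m (drop k w)) _ ⟩
  occ m (take k w) + occ m (drop k w)     ≡⟨ sym (occ-++ m (take k w) (drop k w)) ⟩
  occ m (take k w ++ drop k w)            ≡⟨ cong (occ m) (take++drop≡id k w) ⟩
  occ m w                                 ∎
  where open ≡-Reasoning

All-rotate : ∀ {P : ℕ → Set} k {w} → All P w → All P (rotate k w)
All-rotate k pw = ++⁺ (drop⁺ k pw) (take⁺ k pw)

rotate-all : ∀ k w → length w ≤ k → rotate k w ≡ w
rotate-all k w w≤k rewrite drop-all k w w≤k = take-all k w w≤k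

rotate-length : ∀ w → rotate (length w) w ≡ w
rotate-length w = rotate-all (length w) w ≤-refl

rotate-+ : ∀ m n w → m + n ≤ length w → rotate m (rotate n w) ≡ rotate (m + n) w
rotate-+ m n w m+n≤ = begin
  drop m (D ++ Tk) ++ take m (D ++ Tk)   ≡⟨ cong₂ _++_ (drop-++ˡ m D Tk m≤D) (take-++ˡ m D Tk m≤D) ⟩
  (drop m D ++ Tk) ++ take m D          ≡⟨ ++-assoc (drop m D) Tk (take m D) ⟩
  drop m D ++ (Tk ++ take m D)          ≡⟨ cong₂ _++_ (trans (drop-drop n m w) (cong (λ k → drop k w) (+-comm n m)))
                                                      (trans (sym (take-+ n m w)) (cong (λ k → take k w) (+-comm n m))) ⟩
  drop (m + n) w ++ take (m + n) w     ∎
  where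
  open ≡-Reasoning
  D = drop n w
  Tk = take n w
  m≤D : m ≤ length D
  m≤D = subst (m ≤_) (sym (length-drop n w)) (m+n≤o⇒m≤o∸n m m+n≤)

rotate-wrap : ∀ n c w → n ≤ length w → c ≤ n → rotate ((length w ∸ n) + c) (rotate n w) ≡ rotate c w
rotate-wrap n c w n≤ c≤n = begin
  rotate ((length w ∸ n) + c) (D ++ Tk)               ≡⟨ cong (λ k → rotate (k + c) (D ++ Tk)) (sym (length-drop n w)) ⟩
  drop (length D + c) (D ++ Tk) ++ take (length D + c) (D ++ Tk)
                                                     ≡⟨ cong₂ _++_ (drop-++ʳ c D Tk) (take-++ʳ c D Tk) ⟩
  drop c Tk ++ (D ++ take c Tk)                        ≡⟨ sym (++-assoc (drop c Tk) D (take c Tk)) ⟩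
  (drop c Tk ++ D) ++ take c Tk                        ≡⟨ cong₂ _++_ (trans (sym (drop-++ˡ c Tk D c≤T)) (cong (drop c) (take++drop≡id n w)))
                                                                   (take-take≤ w c≤n) ⟩
  drop c w ++ take c w                               ∎
  where
  open ≡-Reasoning
  D = drop n w
  Tk = take n w
  c≤T : c ≤ length Tk
  c≤T = subst (c ≤_) (sym (length-take≤ w n≤)) c≤n

rotate-injective : ∀ k x y → rotate k x ≡ rotate k y → x ≡ y
rotate-injective k x y eq with k ≤? length x
... | no k≰x = begin
  x            ≡⟨ sym (rotate-all k x (≰⇒≥ k≰x)) ⟩
  rotate k x   ≡⟨ eq ⟩
  rotate k y   ≡⟨ rotate-all k y (subst (_≤ k) x≡y (≰⇒≥ k≰x)) ⟩
  y            ∎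
  where
  open ≡-Reasoning
  x≡y : length x ≡ length y
  x≡y = trans (sym (length-rotate k x)) (trans (cong length eq) (length-rotate k y))
... | yes k≤x = begin
  x                                     ≡⟨ sym (rotate-length x) ⟩
  rotate (length x) x                   ≡⟨ cong (λ m → rotate m x) (sym (m∸n+n≡m k≤x)) ⟩
  rotate (length x ∸ k + k) x           ≡⟨ sym (rotate-+ (length x ∸ k) k x (≤-reflexive (m∸n+n≡m k≤x))) ⟩
  rotate (length x ∸ k) (rotate k x)    ≡⟨ cong (rotate (length x ∸ k)) eq ⟩
  rotate (length x ∸ k) (rotate k y)    ≡⟨ rotate-+ (length x ∸ k) k y (≤-reflexive full) ⟩
  rotate (length x ∸ k + k) y           ≡⟨ cong (λ m → rotate m y) full ⟩
  rotate (length y) y                   ≡⟨ rotate-length y ⟩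
  y                                     ∎
  where
  open ≡-Reasoning
  full : length x ∸ k + k ≡ length y
  full = trans (m∸n+n≡m k≤x) (trans (sym (length-rotate k x)) (trans (cong length eq) (length-rotate k y)))

-- addMod n c s is (c + s) mod n whenever c ≤ n and s < n.
addMod : ℕ → ℕ → ℕ → ℕ
addMod n c s with c + s <? n
... | yes _ = c + s
... | no _  = c + s ∸ n

addMod<n : ∀ {n c s} → c ≤ n → s < n → addMod n c s < n
addMod<n {n} {c} {s} c≤n s<n with c + s <? n
... | yes c+s<n = c+s<n
... | no _      = ≤-<-trans (m≤n+o⇒m∸n≤o (c + s) n (+-monoˡ-≤ s c≤n)) s<n

rotate-rotate : ∀ c s w → c ≤ length w → s < length w → rotate c (rotate s w) ≡ rotate (addMod (length w) c s) w
rotate-rotate c s w c≤n s<n with c + s <? length w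
... | yes c+s<n = rotate-+ c s w (<⇒≤ c+s<n)
... | no c+s≮n  = begin
  rotate c (rotate s w)                       ≡⟨ cong (λ k → rotate k (rotate s w)) (sym split) ⟩
  rotate ((n ∸ s) + (c + s ∸ n)) (rotate s w) ≡⟨ rotate-wrap s (c + s ∸ n) w (<⇒≤ s<n) c+s∸n≤s ⟩
  rotate (c + s ∸ n) w                        ∎
  where
  open ≡-Reasoning
  n = length w
  n≤c+s : n ≤ c + s
  n≤c+s = ≮⇒≥ c+s≮n
  c+s∸n≤s : c + s ∸ n ≤ s
  c+s∸n≤s = m≤n+o⇒m∸n≤o (c + s) n (+-monoˡ-≤ s c≤n)
  split : (n ∸ s) + (c + s ∸ n) ≡ c
  split = +-cancelʳ-≡ s _ c (begin
    (n ∸ s) + (c + s ∸ n) + s   ≡⟨ +-assoc (n ∸ s) _ s ⟩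
    (n ∸ s) + (c + s ∸ n + s)   ≡⟨ cong ((n ∸ s) +_) (+-comm (c + s ∸ n) s) ⟩
    (n ∸ s) + (s + (c + s ∸ n)) ≡⟨ sym (+-assoc (n ∸ s) s _) ⟩
    (n ∸ s) + s + (c + s ∸ n)   ≡⟨ cong (_+ (c + s ∸ n)) (m∸n+n≡m (<⇒≤ s<n)) ⟩
    n + (c + s ∸ n)             ≡⟨ m+[n∸m]≡n n≤c+s ⟩
    c + s                       ∎)

∑<-addMod : ∀ n c (g : ℕ → ℕ) → c ≤ n → ∑< n (λ s → g (addMod n c s)) ≡ ∑< n g
∑<-addMod n c g c≤n = begin
  ∑< n F                                                ≡⟨ cong (λ m → ∑< m F) (sym (m∸n+n≡m c≤n)) ⟩
  ∑< ((n ∸ c) + c) F                                    ≡⟨ ∑<-+ (n ∸ c) c F ⟩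
  ∑< (n ∸ c) F + ∑< c (λ i → F (n ∸ c + i))             ≡⟨ cong₂ _+_ (∑<-cong-< (n ∸ c) below) (∑<-cong-< c above) ⟩
  ∑< (n ∸ c) (λ s → g (c + s)) + ∑< c g                 ≡⟨ +-comm _ (∑< c g) ⟩
  ∑< c g + ∑< (n ∸ c) (λ s → g (c + s))                 ≡⟨ sym (∑<-+ c (n ∸ c) g) ⟩
  ∑< (c + (n ∸ c)) g                                    ≡⟨ cong (λ m → ∑< m g) (m+[n∸m]≡n c≤n) ⟩
  ∑< n g                                                ∎
  where
  open ≡-Reasoning
  F : ℕ → ℕ
  F s = g (addMod n c s)
  below : ∀ s → s < n ∸ c → F s ≡ g (c + s)
  below s s< with c + s <? n
  ... | yes _    = refl
  ... | no c+s≮n = ⊥-elim (c+s≮n (subst (c + s <_) (m+[n∸m]≡n c≤n) (+-monoʳ-< c s<)))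
  wrap : ∀ i → c + (n ∸ c + i) ≡ n + i
  wrap i = trans (sym (+-assoc c (n ∸ c) i)) (cong (_+ i) (m+[n∸m]≡n c≤n))
  above : ∀ i → i < c → F (n ∸ c + i) ≡ g i
  above i i<c with c + (n ∸ c + i) <? n
  ... | yes lt = ⊥-elim (<⇒≱ lt (subst (n ≤_) (sym (wrap i)) (m≤m+n n i)))
  ... | no _   = cong g (trans (cong (_∸ n) (wrap i)) (m+n∸m≡n n i))

rotate-reach : ∀ w s t → s < length w → t < length w → ∃[ r ] (r < length w × rotate r (rotate s w) ≡ rotate t w)
rotate-reach w s t s<n t<n with s ≤? t
... | yes s≤t = t ∸ s , ≤-<-trans (m∸n≤m t s) t<n ,
                trans (rotate-+ (t ∸ s) s w (subst (_≤ length w) (sym (m∸n+n≡m s≤t)) (<⇒≤ t<n)))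
                      (cong (λ k → rotate k w) (m∸n+n≡m s≤t))
... | no s≰t = (length w ∸ s) + t , r<n , rotate-wrap s t w (<⇒≤ s<n) (<⇒≤ (≰⇒> s≰t))
  where
  r<n : (length w ∸ s) + t < length w
  r<n = subst ((length w ∸ s) + t <_) (m∸n+n≡m (<⇒≤ s<n)) (+-monoʳ-< (length w ∸ s) (≰⇒> s≰t))

-- Necklace words

≤lex-refl : ∀ u → u ≤lex u
≤lex-refl u = Lex.≤-reflexive _≡_ _≤_ (≡⇒Pointwise-≡ refl)

≤lex-antisym : ∀ {u v} → u ≤lex v → v ≤lex u → u ≡ v
≤lex-antisym u≤v v≤u = Pointwise-≡⇒≡ (Lex.≤-antisymmetric sym ≤-antisym u≤v v≤u)

≤lex-trans : ∀ {u v w} → u ≤lex v → v ≤lex w → u ≤lex w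
≤lex-trans = Lex.≤-transitive ≤-isPartialOrder

≤lex-total : ∀ u v → u ≤lex v ⊎ v ≤lex u
≤lex-total = Lex.≤-total sym _≟_ ≤-antisym ≤-total

≤lex-head : ∀ {x y xs ys} → (x ∷ xs) ≤lex (y ∷ ys) → x ≤ y
≤lex-head (this (x≤y , _)) = x≤y
≤lex-head (next refl _)    = ≤-refl

IsNecklace⇒≤lex-rotate : ∀ {u} → IsNecklace u → ∀ {r} → r < length u → u ≤lex rotate r u
IsNecklace⇒≤lex-rotate {u} = applyUpTo⁻ (λ k → rotate k u) (length u)

≤lex-rotate⇒IsNecklace : ∀ u → (∀ r → r < length u → u ≤lex rotate r u) → IsNecklace u
≤lex-rotate⇒IsNecklace u ≤rot = applyUpTo⁺₁ (λ k → rotate k u) (length u) (λ {r} → ≤rot r)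

lex-argmin : ∀ (f : ℕ → Word) n → ∃[ t ] (t < suc n × (∀ r → r < suc n → f t ≤lex f r))
lex-argmin f zero = 0 , z<s , λ { 0 _ → ≤lex-refl (f 0) ; (suc r) (s≤s ()) }
lex-argmin f (suc n) with lex-argmin f n
... | t , t<n , min with ≤lex-total (f t) (f (suc n))
...   | inj₁ ft≤ = t , m<n⇒m<1+n t<n , minimal
  where
  minimal : ∀ r → r < suc (suc n) → f t ≤lex f r
  minimal r r< with m<1+n⇒m<n∨m≡n r<
  ... | inj₁ r<n  = min r r<n
  ... | inj₂ refl = ft≤
...   | inj₂ ≤ft = suc n , ≤-refl , minimal
  where
  minimal : ∀ r → r < suc (suc n) → f (suc n) ≤lex f r
  minimal r r< with m<1+n⇒m<n∨m≡n r<
  ... | inj₁ r<n  = ≤lex-trans ≤ft (min r r<n)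
  ... | inj₂ refl = ≤lex-refl (f (suc n))

necklace-rotation-exists : ∀ w → 0 < length w → ∃[ t ] (t < length w × IsNecklace (rotate t w))
necklace-rotation-exists w n>0 with length w in n≡
... | suc n with lex-argmin (λ r → rotate r w) n
...   | t , t<n , min = t , t<n , ≤lex-rotate⇒IsNecklace (rotate t w) ≤rot
  where
  t<w : t < length w
  t<w = subst (t <_) (sym n≡) t<n
  ≤rot : ∀ r → r < length (rotate t w) → rotate t w ≤lex rotate r (rotate t w)
  ≤rot r r< = subst (rotate t w ≤lex_) (sym (rotate-rotate r t w (<⇒≤ r<w) t<w))
                    (min _ (subst (addMod (length w) r t <_) n≡ (addMod<n (<⇒≤ r<w) t<w)))
    where
    r<w : r < length w
    r<w = subst (r <_) (length-rotate t w) r<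

-- Any two necklace rotations of w are rotations of each other, hence mutually ≤lex.
necklace-rotation-unique : ∀ w s t → s < length w → t < length w →
  IsNecklace (rotate s w) → IsNecklace (rotate t w) → rotate s w ≡ rotate t w
necklace-rotation-unique w s t s<n t<n ns nt
  with rotate-reach w s t s<n t<n | rotate-reach w t s t<n s<n
... | r , r<n , s→t | r′ , r′<n , t→s = ≤lex-antisym
  (subst (rotate s w ≤lex_) s→t (IsNecklace⇒≤lex-rotate ns (subst (r <_) (sym (length-rotate s w)) r<n)))
  (subst (rotate t w ≤lex_) t→s (IsNecklace⇒≤lex-rotate nt (subst (r′ <_) (sym (length-rotate t w)) r′<n)))

necklace-head-minimal : ∀ {x xs} → IsNecklace (x ∷ xs) → ∀ {y} → y ∈ x ∷ xs → x ≤ y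
necklace-head-minimal {x} {xs} nec y∈ with ∈⇒drop≡∷ y∈
... | k , k< , rest , eq =
  ≤lex-head (subst (λ v → (x ∷ xs) ≤lex (v ++ take k (x ∷ xs))) eq (IsNecklace⇒≤lex-rotate nec k<))

replicate-IsNecklace : ∀ n (y : ℕ) → IsNecklace (replicate n y)
replicate-IsNecklace n y = ≤lex-rotate⇒IsNecklace w (λ r _ → subst (w ≤lex_) (sym (rotate-replicate r)) (≤lex-refl w))
  where
  w = replicate n y
  rotate-replicate : ∀ r → rotate r w ≡ w
  rotate-replicate r = trans (All≡⇒≡replicate (All-rotate r (replicate⁺ n refl)))
                             (cong (λ m → replicate m y) (trans (length-rotate r w) (length-replicate n)))

-- Burnside's lemma for rotations of binary words

necklaceCount : ℕ → ℕ → ℕ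
necklaceCount n k = ∑ (binaryWords n) (λ w → 𝟙 (isNecklace? w) * 𝟙 (occ 2 w ≟ k))

fixedCount : ℕ → ℕ → ℕ → ℕ
fixedCount n k s = ∑ (binaryWords n) (λ w → 𝟙 (occ 2 w ≟ k) * 𝟙 (rotate s w ≟ʷ w))

-- With u = rotate t w the necklace rotation of w, rotate s w is a necklace iff it is u,
-- iff rotating it further by n ∸ t gives back w.
#necklace-rotations≡#fixing-rotations : ∀ w → 0 < length w →
  ∑< (length w) (λ s → 𝟙 (isNecklace? (rotate s w))) ≡ ∑< (length w) (λ s → 𝟙 (rotate s w ≟ʷ w))
#necklace-rotations≡#fixing-rotations w n>0 with necklace-rotation-exists w n>0
... | t , t<n , u-nec = trans (∑<-cong-< n necklace⇔fixed) (∑<-addMod n c (λ s → 𝟙 (rotate s w ≟ʷ w)) (m∸n≤m n t))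
  where
  n = length w
  c = n ∸ t
  u = rotate t w
  rotate-c-u : rotate c u ≡ w
  rotate-c-u = begin
    rotate c (rotate t w)   ≡⟨ rotate-+ c t w (≤-reflexive (m∸n+n≡m (<⇒≤ t<n))) ⟩
    rotate (c + t) w        ≡⟨ cong (λ k → rotate k w) (m∸n+n≡m (<⇒≤ t<n)) ⟩
    rotate n w              ≡⟨ rotate-length w ⟩
    w                       ∎
    where open ≡-Reasoning
  necklace⇔fixed : ∀ s → s < n → 𝟙 (isNecklace? (rotate s w)) ≡ 𝟙 (rotate (addMod n c s) w ≟ʷ w)
  necklace⇔fixed s s<n = 𝟙-⇔ to from (isNecklace? (rotate s w)) (rotate (addMod n c s) w ≟ʷ w)
    where
    to : IsNecklace (rotate s w) → rotate (addMod n c s) w ≡ w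
    to s-nec = trans (sym (rotate-rotate c s w (m∸n≤m n t) s<n))
                     (trans (cong (rotate c) (necklace-rotation-unique w s t s<n t<n s-nec u-nec)) rotate-c-u)
    from : rotate (addMod n c s) w ≡ w → IsNecklace (rotate s w)
    from eq = subst IsNecklace (sym (rotate-injective c (rotate s w) u
                (trans (rotate-rotate c s w (m∸n≤m n t) s<n) (trans eq (sym rotate-c-u))))) u-nec

∑-binaryWords-rotate : ∀ n s → s ≤ n → (h : Word → ℕ) → ∑ (binaryWords n) (λ w → h (rotate s w)) ≡ ∑ (binaryWords n) h
∑-binaryWords-rotate n s s≤n h = begin
  ∑ (binaryWords n) (λ w → h (rotate s w))   ≡⟨ sym (∑-map (rotate s) (binaryWords n) h) ⟩
  ∑ (map (rotate s) (binaryWords n)) h       ≡⟨ ∑-reindex _≟ʷ_ (map⁺ (rotate-injective s _ _) (binaryWords-unique n)) (binaryWords-unique n)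
                                                  ⊆image image⊆ h ⟩
  ∑ (binaryWords n) h                        ∎
  where
  open ≡-Reasoning
  rotate-binaryWord : ∀ k {w} → w ∈ binaryWords n → rotate k w ∈ binaryWords n
  rotate-binaryWord k {w} w∈ with binaryWords-sound n w∈
  ... | len , bin = binaryWords-complete (trans (length-rotate k w) len) (All-rotate k bin)
  ⊆image : ∀ w → w ∈ binaryWords n → w ∈ map (rotate s) (binaryWords n)
  ⊆image w w∈ = subst (_∈ map (rotate s) (binaryWords n)) back (∈-map⁺ (rotate s) (rotate-binaryWord (n ∸ s) w∈))
    where
    n≡ : s + (n ∸ s) ≡ length w
    n≡ = trans (m+[n∸m]≡n s≤n) (sym (proj₁ (binaryWords-sound n w∈)))
    back : rotate s (rotate (n ∸ s) w) ≡ w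
    back = trans (rotate-+ s (n ∸ s) w (≤-reflexive n≡)) (trans (cong (λ k → rotate k w) n≡) (rotate-length w))
  image⊆ : ∀ w → w ∈ map (rotate s) (binaryWords n) → w ∈ binaryWords n
  image⊆ w w∈ with ∈-map⁻ (rotate s) w∈
  ... | v , v∈ , refl = rotate-binaryWord s v∈

burnside : ∀ n k → 0 < n → n * necklaceCount n k ≡ ∑< n (fixedCount n k)
burnside n k n>0 = begin
  n * necklaceCount n k
    ≡⟨ sym (∑<-const n (necklaceCount n k)) ⟩
  ∑< n (λ s → necklaceCount n k)
    ≡⟨ ∑<-cong-< n (λ s s<n → sym (rotated s (<⇒≤ s<n))) ⟩
  ∑< n (λ s → ∑ (binaryWords n) (λ w → 𝟙 (isNecklace? (rotate s w)) * 𝟙 (occ 2 w ≟ k)))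
    ≡⟨ ∑-comm (upTo n) (binaryWords n) _ ⟩
  ∑ (binaryWords n) (λ w → ∑< n (λ s → 𝟙 (isNecklace? (rotate s w)) * 𝟙 (occ 2 w ≟ k)))
    ≡⟨ ∑-cong-∈ (binaryWords n) per-word ⟩
  ∑ (binaryWords n) (λ w → ∑< n (λ s → 𝟙 (occ 2 w ≟ k) * 𝟙 (rotate s w ≟ʷ w)))
    ≡⟨ sym (∑-comm (upTo n) (binaryWords n) _) ⟩
  ∑< n (fixedCount n k) ∎
  where
  open ≡-Reasoning
  rotated : ∀ s → s ≤ n → ∑ (binaryWords n) (λ w → 𝟙 (isNecklace? (rotate s w)) * 𝟙 (occ 2 w ≟ k)) ≡ necklaceCount n k
  rotated s s≤n = trans (∑-cong (binaryWords n) (λ w → cong (𝟙 (isNecklace? (rotate s w)) *_)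
                            (𝟙-⇔ (trans (occ-rotate 2 s w)) (trans (sym (occ-rotate 2 s w))) (occ 2 w ≟ k) (occ 2 (rotate s w) ≟ k))))
                        (∑-binaryWords-rotate n s s≤n (λ w → 𝟙 (isNecklace? w) * 𝟙 (occ 2 w ≟ k)))
  per-word : ∀ w → w ∈ binaryWords n →
    ∑< n (λ s → 𝟙 (isNecklace? (rotate s w)) * 𝟙 (occ 2 w ≟ k)) ≡ ∑< n (λ s → 𝟙 (occ 2 w ≟ k) * 𝟙 (rotate s w ≟ʷ w))
  per-word w w∈ = begin
    ∑< n (λ s → 𝟙 (isNecklace? (rotate s w)) * 𝟙 (occ 2 w ≟ k))
      ≡⟨ ∑-*ʳ (upTo n) _ (λ s → 𝟙 (isNecklace? (rotate s w))) ⟩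
    ∑< n (λ s → 𝟙 (isNecklace? (rotate s w))) * 𝟙 (occ 2 w ≟ k)
      ≡⟨ cong (_* 𝟙 (occ 2 w ≟ k)) (subst (λ m → ∑< m _ ≡ ∑< m _) len
                                     (#necklace-rotations≡#fixing-rotations w (subst (0 <_) (sym len) n>0))) ⟩
    ∑< n (λ s → 𝟙 (rotate s w ≟ʷ w)) * 𝟙 (occ 2 w ≟ k)
      ≡⟨ *-comm _ (𝟙 (occ 2 w ≟ k)) ⟩
    𝟙 (occ 2 w ≟ k) * ∑< n (λ s → 𝟙 (rotate s w ≟ʷ w))
      ≡⟨ sym (∑-*ˡ (upTo n) (𝟙 (occ 2 w ≟ k)) (λ s → 𝟙 (rotate s w ≟ʷ w))) ⟩
    ∑< n (λ s → 𝟙 (occ 2 w ≟ k) * 𝟙 (rotate s w ≟ʷ w)) ∎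
    where
    len : length w ≡ n
    len = proj₁ (binaryWords-sound n w∈)

-- Words fixed by a rotation are powers

pow : ℕ → Word → Word
pow zero    z = []
pow (suc c) z = z ++ pow c z

pow-+ : ∀ a b z → pow (a + b) z ≡ pow a z ++ pow b z
pow-+ zero    b z = refl
pow-+ (suc a) b z = trans (cong (z ++_) (pow-+ a b z)) (sym (++-assoc z (pow a z) (pow b z)))

length-pow : ∀ c z → length (pow c z) ≡ c * length z
length-pow zero    z = refl
length-pow (suc c) z = trans (length-++ z) (cong (length z +_) (length-pow c z))

All-pow : ∀ {P : ℕ → Set} c {z} → All P z → All P (pow c z)
All-pow zero    pz = []
All-pow (suc c) pz = ++⁺ pz (All-pow c pz)

occ-pow : ∀ m c z → occ m (pow c z) ≡ c * occ m z
occ-pow m zero    z = refl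
occ-pow m (suc c) z = trans (occ-++ m z (pow c z)) (cong (occ m z +_) (occ-pow m c z))

pow-injective : ∀ c x y → pow (suc c) x ≡ pow (suc c) y → x ≡ y
pow-injective c x y eq = begin
  x                               ≡⟨ sym (take-length-++ x (pow c x)) ⟩
  take (length x) (pow (suc c) x) ≡⟨ cong₂ take x≡y eq ⟩
  take (length y) (pow (suc c) y) ≡⟨ take-length-++ y (pow c y) ⟩
  y                               ∎
  where
  open ≡-Reasoning
  x≡y : length x ≡ length y
  x≡y = *-cancelˡ-≡ (length x) (length y) (suc c) (trans (sym (length-pow (suc c) x)) (trans (cong length eq) (length-pow (suc c) y)))

rotate-pow : ∀ m c z → m ≤ c → rotate (m * length z) (pow c z) ≡ pow c z
rotate-pow m c z m≤c = begin
  rotate (m * length z) (pow c z)                    ≡⟨ cong₂ rotate (sym (length-pow m z)) split ⟩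
  rotate (length (pow m z)) (pow m z ++ pow (c ∸ m) z) ≡⟨ cong₂ _++_ (drop-length-++ (pow m z) _) (take-length-++ (pow m z) _) ⟩
  pow (c ∸ m) z ++ pow m z                           ≡⟨ sym (pow-+ (c ∸ m) m z) ⟩
  pow (c ∸ m + m) z                                  ≡⟨ cong (λ k → pow k z) (m∸n+n≡m m≤c) ⟩
  pow c z                                            ∎
  where
  open ≡-Reasoning
  split : pow c z ≡ pow m z ++ pow (c ∸ m) z
  split = trans (cong (λ k → pow k z) (sym (m+[n∸m]≡n m≤c))) (pow-+ m (c ∸ m) z)

gcd[m,n∸m]≡gcd[m,n] : ∀ m n → m ≤ n → gcd m (n ∸ m) ≡ gcd m n
gcd[m,n∸m]≡gcd[m,n] m n m≤n = ∣-antisym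
  (gcd-greatest (gcd[m,n]∣m m (n ∸ m)) (∣m∸n∣n⇒∣m (gcd m (n ∸ m)) m≤n (gcd[m,n]∣n m (n ∸ m)) (gcd[m,n]∣m m (n ∸ m))))
  (gcd-greatest (gcd[m,n]∣m m n) (∣m+n∣m⇒∣n (subst (gcd m n ∣_) (sym (m+[n∸m]≡n m≤n)) (gcd[m,n]∣n m n)) (gcd[m,n]∣m m n)))

record CommonRoot (x y : Word) : Set where
  constructor commonRoot
  field
    root     : Word
    p q      : ℕ
    x≡pow    : x ≡ pow p root
    y≡pow    : y ≡ pow q root
    length-root : length root ≡ gcd (length x) (length y)

CommonRoot-sym : ∀ {x y} → CommonRoot x y → CommonRoot y x
CommonRoot-sym {x} {y} (commonRoot z p q x≡ y≡ len) = commonRoot z q p y≡ x≡ (trans len (gcd-comm (length x) (length y)))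

-- Lyndon–Schützenberger, by the Euclidean algorithm on lengths; `fuel` bounds length x + length y.
commuting⇒CommonRoot : ∀ fuel x y → length x + length y ≤ fuel → x ++ y ≡ y ++ x → CommonRoot x y
commuting-shorter⇒CommonRoot : ∀ fuel x y → length x ≤ length y → length x + length y ≤ fuel → x ++ y ≡ y ++ x → CommonRoot x y

commuting⇒CommonRoot fuel x y bound comm with length x ≤? length y
... | yes x≤y = commuting-shorter⇒CommonRoot fuel x y x≤y bound comm
... | no  x≰y = CommonRoot-sym (commuting-shorter⇒CommonRoot fuel y x (<⇒≤ (≰⇒> x≰y))
                                 (subst (_≤ fuel) (+-comm (length x) (length y)) bound) (sym comm))

commuting-shorter⇒CommonRoot fuel [] y _ _ _ = commonRoot y 0 1 refl (sym (++-identityʳ y)) (sym (gcd-identityˡ (length y)))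
commuting-shorter⇒CommonRoot zero (_ ∷ _) y _ () _
commuting-shorter⇒CommonRoot (suc fuel) x@(_ ∷ x′) y x≤y bound comm =
  extend (commuting⇒CommonRoot fuel x y′ bound′ comm′)
  where
  y′ = drop (length x) y
  y≡x++y′ : y ≡ x ++ y′
  y≡x++y′ = trans (sym (take++drop≡id (length x) y))
                  (cong (_++ y′) (trans (sym (take-++ˡ (length x) y x x≤y)) (trans (cong (take (length x)) (sym comm)) (take-length-++ x y))))
  comm′ : x ++ y′ ≡ y′ ++ x
  comm′ = ++-cancelˡ x (x ++ y′) (y′ ++ x)
            (trans (cong (x ++_) (sym y≡x++y′)) (trans comm (trans (cong (_++ x) y≡x++y′) (++-assoc x y′ x))))
  bound′ : length x + length y′ ≤ fuel
  bound′ = subst (_≤ fuel) (sym (trans (cong (length x +_) (length-drop (length x) y)) (m+[n∸m]≡n x≤y)))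
                 (≤-trans (m≤n+m (length y) (length x′)) (s≤s⁻¹ bound))
  extend : CommonRoot x y′ → CommonRoot x y
  extend (commonRoot z p q x≡ y′≡ len) = commonRoot z p (p + q) x≡
    (trans y≡x++y′ (trans (cong₂ _++_ x≡ y′≡) (sym (pow-+ p q z))))
    (trans len (trans (cong (gcd (length x)) (length-drop (length x) y)) (gcd[m,n∸m]≡gcd[m,n] (length x) (length y) x≤y)))

rotate-pow-fixed : ∀ {s n c} z .{{_ : NonZero (length z)}} → s < n → gcd s n ≡ length z → c * length z ≡ n →
                   rotate s (pow c z) ≡ pow c z
rotate-pow-fixed {s} {n} {c} z s<n gcd≡ cz≡n with gcd[m,n]∣m s n
... | divides m s≡ = trans (cong (λ k → rotate k (pow c z)) s≡mz) (rotate-pow m c z m≤c)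
  where
  s≡mz : s ≡ m * length z
  s≡mz = trans s≡ (cong (m *_) gcd≡)
  m≤c : m ≤ c
  m≤c = *-cancelʳ-≤ m c (length z) (subst₂ _≤_ s≡mz (sym cz≡n) (<⇒≤ s<n))

fixed⇒pow : ∀ {s c g} w .{{_ : NonZero g}} → s < length w → gcd s (length w) ≡ g → c * g ≡ length w →
            rotate s w ≡ w → ∃[ z ] (length z ≡ g × w ≡ pow c z)
fixed⇒pow {s} {c} {g} w s<n gcd≡ cg≡n fixed = root , length-root≡g , trans w≡pow[p+q] (cong (λ k → pow k root) p+q≡c)
  where
  comm : take s w ++ drop s w ≡ drop s w ++ take s w
  comm = trans (take++drop≡id s w) (sym fixed)
  open CommonRoot (commuting⇒CommonRoot _ (take s w) (drop s w) ≤-refl comm)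
  length-root≡g : length root ≡ g
  length-root≡g = begin
    length root                                   ≡⟨ length-root ⟩
    gcd (length (take s w)) (length (drop s w))   ≡⟨ cong₂ gcd (length-take≤ w (<⇒≤ s<n)) (length-drop s w) ⟩
    gcd s (length w ∸ s)                          ≡⟨ gcd[m,n∸m]≡gcd[m,n] s (length w) (<⇒≤ s<n) ⟩
    gcd s (length w)                              ≡⟨ gcd≡ ⟩
    g                                             ∎
    where open ≡-Reasoning
  w≡pow[p+q] : w ≡ pow (p + q) root
  w≡pow[p+q] = trans (sym (take++drop≡id s w)) (trans (cong₂ _++_ x≡pow y≡pow) (sym (pow-+ p q root)))
  p+q≡c : p + q ≡ c
  p+q≡c = *-cancelʳ-≡ (p + q) c g (begin
    (p + q) * g              ≡⟨ cong ((p + q) *_) (sym length-root≡g) ⟩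
    (p + q) * length root    ≡⟨ sym (length-pow (p + q) root) ⟩
    length (pow (p + q) root) ≡⟨ cong length (sym w≡pow[p+q]) ⟩
    length w                 ≡⟨ sym cg≡n ⟩
    c * g                    ∎)
    where open ≡-Reasoning

𝟙-*≟ : ∀ c x k .{{_ : NonZero c}} → 𝟙 (c * x ≟ k) ≡ 𝟙 (c ∣? k) * 𝟙 (x ≟ k / c)
𝟙-*≟ c x k with c ∣? k
... | yes c∣k = trans (𝟙-⇔ to from (c * x ≟ k) (x ≟ k / c)) (sym (+-identityʳ _))
  where
  to : c * x ≡ k → x ≡ k / c
  to eq = trans (sym (m*n/n≡m x c)) (cong (_/ c) (trans (*-comm x c) eq))
  from : x ≡ k / c → c * x ≡ k
  from eq = trans (cong (c *_) eq) (m*[n/m]≡n c∣k)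
... | no c∤k = 𝟙-no (λ eq → c∤k (divides x (trans (sym eq) (*-comm c x)))) (c * x ≟ k)

-- The words of length n = (1 + c) g fixed by rotation by s, where gcd s n = g, are the
-- (1 + c)-th powers of words of length g; such a power has k letters 2 iff 1 + c divides k.
fixedCount≡ : ∀ n k s c g .{{_ : NonZero g}} → s < n → gcd s n ≡ g → suc c * g ≡ n →
              fixedCount n k s ≡ 𝟙 (suc c ∣? k) * (g C (k / suc c))
fixedCount≡ n k s c g s<n gcd≡ cg≡n = begin
  fixedCount n k s
    ≡⟨ ∑-cong (binaryWords n) (λ w → *-comm (𝟙 (occ 2 w ≟ k)) _) ⟩
  ∑ (binaryWords n) (λ w → 𝟙 (fixed? w) * h w)
    ≡⟨ sym (∑-filter fixed? (binaryWords n) h) ⟩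
  ∑ (filter fixed? (binaryWords n)) h
    ≡⟨ ∑-reindex _≟ʷ_ (filter⁺ fixed? (binaryWords-unique n)) (map⁺ (pow-injective c _ _) (binaryWords-unique g))
                      powers⊆fixed fixed⊆powers h ⟩
  ∑ (map (pow (suc c)) (binaryWords g)) h
    ≡⟨ ∑-map (pow (suc c)) (binaryWords g) h ⟩
  ∑ (binaryWords g) (λ z → 𝟙 (occ 2 (pow (suc c) z) ≟ k))
    ≡⟨ ∑-cong (binaryWords g) (λ z → trans (cong (λ m → 𝟙 (m ≟ k)) (occ-pow 2 (suc c) z)) (𝟙-*≟ (suc c) (occ 2 z) k)) ⟩
  ∑ (binaryWords g) (λ z → 𝟙 (suc c ∣? k) * 𝟙 (occ 2 z ≟ k / suc c))
    ≡⟨ ∑-*ˡ (binaryWords g) (𝟙 (suc c ∣? k)) _ ⟩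
  𝟙 (suc c ∣? k) * ∑ (binaryWords g) (λ z → 𝟙 (occ 2 z ≟ k / suc c))
    ≡⟨ cong (𝟙 (suc c ∣? k) *_) (∑-binaryWords-occ₂ g (k / suc c)) ⟩
  𝟙 (suc c ∣? k) * (g C (k / suc c)) ∎
  where
  open ≡-Reasoning
  h : Word → ℕ
  h w = 𝟙 (occ 2 w ≟ k)
  fixed? : (w : Word) → Dec (rotate s w ≡ w)
  fixed? w = rotate s w ≟ʷ w
  powers⊆fixed : ∀ w → w ∈ map (pow (suc c)) (binaryWords g) → w ∈ filter fixed? (binaryWords n)
  powers⊆fixed w w∈ with ∈-map⁻ (pow (suc c)) w∈
  ... | z , z∈ , refl with binaryWords-sound g z∈
  ...   | refl , z-bin = ∈-filter⁺ fixed? (binaryWords-complete (trans (length-pow (suc c) z) cg≡n) (All-pow (suc c) z-bin))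
                                            (rotate-pow-fixed {c = suc c} z s<n gcd≡ cg≡n)
  fixed⊆powers : ∀ w → w ∈ filter fixed? (binaryWords n) → w ∈ map (pow (suc c)) (binaryWords g)
  fixed⊆powers w w∈ with ∈-filter⁻ fixed? w∈
  ... | w∈n , fixed with binaryWords-sound n w∈n
  ...   | refl , w-bin with fixed⇒pow {c = suc c} w s<n gcd≡ cg≡n fixed
  ...     | z , len , refl = ∈-map⁺ (pow (suc c)) (binaryWords-complete len (++⁻ˡ z w-bin))

-- Counting rotations by their order

-- Division with the junk value m ÷ 0 = 0, so that no NonZero instance is needed.
_÷_ : ℕ → ℕ → ℕ
m ÷ zero  = 0
m ÷ suc d = m / suc d

order-decomposition : ∀ n s → 0 < n →
  ∃[ c ] ∃[ g ] (gcd s n ≡ suc g × n ÷ gcd s n ≡ suc c × suc c * suc g ≡ n)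
order-decomposition n s n>0 with gcd s n in gcd≡ | gcd[m,n]∣n s n
... | zero  | _ = ⊥-elim (<⇒≢ n>0 (sym (gcd[m,n]≡0⇒n≡0 s gcd≡)))
... | suc g | g∣n with n / suc g in c≡
...   | zero  = ⊥-elim (<⇒≢ n>0 (trans (sym (cong (_* suc g) c≡)) (m/n*n≡m g∣n)))
...   | suc c = c , g , refl , refl , trans (cong (_* suc g) (sym c≡)) (m/n*n≡m g∣n)

totient≡∑<-coprime : ∀ d → ∑< d (λ t → 𝟙 (gcd t d ≟ 1)) ≡ totient d
totient≡∑<-coprime zero        = refl
totient≡∑<-coprime d@(suc d′) = sym (begin
  totient d                                  ≡⟨ length-filter≡∑𝟙 (λ t → gcd t d ≟ 1) (applyUpTo suc d) ⟩
  ∑ (applyUpTo suc d) (λ t → coprime t)      ≡⟨ ∑-applyUpTo suc d coprime ⟩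
  ∑< d (λ t → coprime (suc t))               ≡⟨ ∑<-sucʳ d′ (λ t → coprime (suc t)) ⟩
  ∑< d′ (λ t → coprime (suc t)) + coprime d  ≡⟨ +-comm _ (coprime d) ⟩
  coprime d + ∑< d′ (λ t → coprime (suc t))  ≡⟨ cong (λ m → 𝟙 (m ≟ 1) + ∑< d′ (λ t → coprime (suc t))) gcd[d,d]≡gcd[0,d] ⟩
  coprime 0 + ∑< d′ (λ t → coprime (suc t))  ≡⟨ sym (∑<-suc d′ coprime) ⟩
  ∑< d coprime                               ∎)
  where
  open ≡-Reasoning
  coprime : ℕ → ℕ
  coprime t = 𝟙 (gcd t d ≟ 1)
  gcd[d,d]≡gcd[0,d] : gcd d d ≡ gcd 0 d
  gcd[d,d]≡gcd[0,d] = trans (∣-antisym (gcd[m,n]∣m d d) (gcd-greatest ∣-refl ∣-refl)) (sym (gcd-identityˡ d))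

-- Among t g, t g + 1, …, t g + g − 1 only t g can have gcd g with d g.
∑<-gcd-block : ∀ t d g .{{_ : NonZero g}} → ∑< g (λ r → 𝟙 (gcd (t * g + r) (d * g) ≟ g)) ≡ 𝟙 (gcd t d ≟ 1)
∑<-gcd-block t d g@(suc g′) = begin
  ∑< g (λ r → 𝟙 (gcd (t * g + r) (d * g) ≟ g))
    ≡⟨ ∑<-suc g′ _ ⟩
  𝟙 (gcd (t * g + 0) (d * g) ≟ g) + ∑< g′ (λ r → 𝟙 (gcd (t * g + suc r) (d * g) ≟ g))
    ≡⟨ cong₂ _+_ first (∑<-zero g′ rest) ⟩
  𝟙 (gcd t d ≟ 1) + 0
    ≡⟨ +-identityʳ _ ⟩
  𝟙 (gcd t d ≟ 1) ∎
  where
  open ≡-Reasoning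
  gcd-scaled : gcd (t * g + 0) (d * g) ≡ g * gcd t d
  gcd-scaled = trans (cong₂ gcd (trans (+-identityʳ _) (*-comm t g)) (*-comm d g)) (sym (c*gcd[m,n]≡gcd[cm,cn] g t d))
  first : 𝟙 (gcd (t * g + 0) (d * g) ≟ g) ≡ 𝟙 (gcd t d ≟ 1)
  first = trans (cong (λ m → 𝟙 (m ≟ g)) gcd-scaled)
                (𝟙-⇔ (λ eq → *-cancelˡ-≡ (gcd t d) 1 g (trans eq (sym (*-identityʳ g))))
                     (λ eq → trans (cong (g *_) eq) (*-identityʳ g)) (g * gcd t d ≟ g) (gcd t d ≟ 1))
  rest : ∀ r → r < g′ → 𝟙 (gcd (t * g + suc r) (d * g) ≟ g) ≡ 0
  rest r r<g′ = 𝟙-no (λ eq → <⇒≱ (s≤s r<g′) (∣⇒≤ (∣m+n∣m⇒∣n (subst (_∣ t * g + suc r) eq (gcd[m,n]∣m (t * g + suc r) (d * g))) (n∣m*n t))))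
                     (gcd (t * g + suc r) (d * g) ≟ g)

∑<-gcd≡ : ∀ d g .{{_ : NonZero g}} → ∑< (d * g) (λ s → 𝟙 (gcd s (d * g) ≟ g)) ≡ totient d
∑<-gcd≡ d g = begin
  ∑< (d * g) (λ s → 𝟙 (gcd s (d * g) ≟ g))                          ≡⟨ ∑<-* d g _ ⟩
  ∑< d (λ t → ∑< g (λ r → 𝟙 (gcd (t * g + r) (d * g) ≟ g)))         ≡⟨ ∑<-cong d (λ t → ∑<-gcd-block t d g) ⟩
  ∑< d (λ t → 𝟙 (gcd t d ≟ 1))                                      ≡⟨ totient≡∑<-coprime d ⟩
  totient d                                                         ∎
  where open ≡-Reasoning

∑<-order≡ : ∀ n d .{{_ : NonZero n}} .{{_ : NonZero d}} →
  ∑< n (λ s → 𝟙 (n ÷ gcd s n ≟ d)) ≡ 𝟙 (d ∣? n) * totient d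
∑<-order≡ n d with d ∣? n
... | no d∤n = ∑<-zero n λ s s<n → order≢d s (order-decomposition n s (≤-<-trans z≤n s<n))
  where
  order≢d : ∀ s → ∃[ c ] ∃[ g ] (gcd s n ≡ suc g × n ÷ gcd s n ≡ suc c × suc c * suc g ≡ n) → 𝟙 (n ÷ gcd s n ≟ d) ≡ 0
  order≢d s (c , g , _ , order≡ , cg≡n) rewrite order≡ =
    𝟙-no (λ { refl → d∤n (divides (suc g) (trans (sym cg≡n) (*-comm d (suc g)))) }) (suc c ≟ d)
... | yes (divides zero n≡0) = ⊥-elim (<⇒≢ (>-nonZero⁻¹ n) (sym n≡0))
... | yes (divides g@(suc _) n≡gd) = begin
  ∑< n (λ s → 𝟙 (n ÷ gcd s n ≟ d))             ≡⟨ ∑<-cong-< n order⇔gcd ⟩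
  ∑< n (λ s → 𝟙 (gcd s n ≟ g))                 ≡⟨ cong (λ m → ∑< m (λ s → 𝟙 (gcd s m ≟ g))) n≡dg ⟩
  ∑< (d * g) (λ s → 𝟙 (gcd s (d * g) ≟ g))     ≡⟨ ∑<-gcd≡ d g ⟩
  totient d                                    ≡⟨ sym (+-identityʳ _) ⟩
  1 * totient d                                ∎
  where
  open ≡-Reasoning
  n≡dg : n ≡ d * g
  n≡dg = trans n≡gd (*-comm g d)
  order⇔gcd : ∀ s → s < n → 𝟙 (n ÷ gcd s n ≟ d) ≡ 𝟙 (gcd s n ≟ g)
  order⇔gcd s s<n with order-decomposition n s (≤-<-trans z≤n s<n)
  ... | c , G , gcd≡ , order≡ , cG≡n rewrite order≡ | gcd≡ = 𝟙-⇔ to from (suc c ≟ d) (suc G ≟ g)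
    where
    to : suc c ≡ d → suc G ≡ g
    to refl = *-cancelˡ-≡ (suc G) g d (trans cG≡n n≡dg)
    from : suc G ≡ g → suc c ≡ d
    from refl = *-cancelʳ-≡ (suc c) d g (trans cG≡n n≡dg)

∑<-by-order : ∀ n (F : ℕ → ℕ) .{{_ : NonZero n}} →
  ∑< n (λ s → F (n ÷ gcd s n)) ≡ ∑< n (λ e → F (suc e) * (𝟙 (suc e ∣? n) * totient (suc e)))
∑<-by-order n F = begin
  ∑< n (λ s → F (n ÷ gcd s n))
    ≡⟨ ∑<-cong-< n select ⟩
  ∑< n (λ s → ∑< n (λ e → 𝟙 (n ÷ gcd s n ≟ suc e) * F (suc e)))
    ≡⟨ ∑-comm (upTo n) (upTo n) _ ⟩
  ∑< n (λ e → ∑< n (λ s → 𝟙 (n ÷ gcd s n ≟ suc e) * F (suc e)))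
    ≡⟨ ∑<-cong n (λ e → ∑-*ʳ (upTo n) (F (suc e)) (λ s → 𝟙 (n ÷ gcd s n ≟ suc e))) ⟩
  ∑< n (λ e → ∑< n (λ s → 𝟙 (n ÷ gcd s n ≟ suc e)) * F (suc e))
    ≡⟨ ∑<-cong n (λ e → trans (cong (_* F (suc e)) (∑<-order≡ n (suc e))) (*-comm _ (F (suc e)))) ⟩
  ∑< n (λ e → F (suc e) * (𝟙 (suc e ∣? n) * totient (suc e))) ∎
  where
  open ≡-Reasoning
  select : ∀ s → s < n → F (n ÷ gcd s n) ≡ ∑< n (λ e → 𝟙 (n ÷ gcd s n ≟ suc e) * F (suc e))
  select s s<n with order-decomposition n s (≤-<-trans z≤n s<n)
  ... | c , g , _ , order≡ , cg≡n rewrite order≡ =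
    sym (∑<-select n c (λ e → F (suc e)) (subst (suc c ≤_) cg≡n (m≤m*n (suc c) (suc g))))

fixedCountOfOrder : ℕ → ℕ → ℕ → ℕ
fixedCountOfOrder n k zero    = 0
fixedCountOfOrder n k (suc c) = 𝟙 (suc c ∣? k) * ((n / suc c) C (k / suc c))

fixedCount≡fixedCountOfOrder : ∀ n k s → s < n → fixedCount n k s ≡ fixedCountOfOrder n k (n ÷ gcd s n)
fixedCount≡fixedCountOfOrder n k s s<n with order-decomposition n s (≤-<-trans z≤n s<n)
... | c , g , gcd≡ , order≡ , cg≡n rewrite order≡ =
  trans (fixedCount≡ n k s c (suc g) s<n gcd≡ cg≡n) (cong (λ m → 𝟙 (suc c ∣? k) * (m C (k / suc c))) (sym n/c≡g))
  where
  n/c≡g : n / suc c ≡ suc g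
  n/c≡g = trans (cong (_/ suc c) (trans (sym cg≡n) (*-comm (suc c) (suc g)))) (m*n/n≡m (suc g) (suc c))

necklaceTerm≡ : ∀ n k e → necklaceTerm n k e ≡ fixedCountOfOrder n k (suc e) * (𝟙 (suc e ∣? n) * totient (suc e))
necklaceTerm≡ n k e with suc e ∣? n | suc e ∣? k
... | yes _ | yes _ = trans (*-comm (totient (suc e)) binomial) (sym (cong₂ _*_ (*-identityˡ binomial) (*-identityˡ (totient (suc e)))))
  where binomial = (n / suc e) C (k / suc e)
... | yes _ | no _  = refl
... | no _  | yes _ = sym (*-zeroʳ (1 * ((n / suc e) C (k / suc e))))
... | no _  | no _  = refl

T≡necklaceCount : ∀ n k → T (suc n) k ≡ necklaceCount (suc n) k
T≡necklaceCount n k = begin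
  sum (applyUpTo (necklaceTerm (suc n) k) (suc n)) / suc n
    ≡⟨ cong (_/ suc n) (sum-applyUpTo (necklaceTerm (suc n) k) (suc n)) ⟩
  ∑< (suc n) (necklaceTerm (suc n) k) / suc n
    ≡⟨ cong (_/ suc n) (sym ∑<-fixedCount≡∑<-necklaceTerm) ⟩
  ∑< (suc n) (fixedCount (suc n) k) / suc n
    ≡⟨ cong (_/ suc n) (trans (sym (burnside (suc n) k z<s)) (*-comm (suc n) _)) ⟩
  necklaceCount (suc n) k * suc n / suc n
    ≡⟨ m*n/n≡m (necklaceCount (suc n) k) (suc n) ⟩
  necklaceCount (suc n) k ∎
  where
  open ≡-Reasoning
  ∑<-fixedCount≡∑<-necklaceTerm : ∑< (suc n) (fixedCount (suc n) k) ≡ ∑< (suc n) (necklaceTerm (suc n) k)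
  ∑<-fixedCount≡∑<-necklaceTerm = begin
    ∑< (suc n) (fixedCount (suc n) k)
      ≡⟨ ∑<-cong-< (suc n) (fixedCount≡fixedCountOfOrder (suc n) k) ⟩
    ∑< (suc n) (λ s → fixedCountOfOrder (suc n) k (suc n ÷ gcd s (suc n)))
      ≡⟨ ∑<-by-order (suc n) (fixedCountOfOrder (suc n) k) ⟩
    ∑< (suc n) (λ e → fixedCountOfOrder (suc n) k (suc e) * (𝟙 (suc e ∣? suc n) * totient (suc e)))
      ≡⟨ ∑<-cong (suc n) (λ e → sym (necklaceTerm≡ (suc n) k e)) ⟩
    ∑< (suc n) (necklaceTerm (suc n) k) ∎

-- Lexical tableaux with two rows

∑-fillings : ∀ n α k (f : Filling → ℕ) → ∑ (fillings (n ∷ α) k) f ≡ ∑ (wordsOver k n) (λ r → ∑ (fillings α k) (λ F → f (r ∷ F)))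
∑-fillings n α k f = trans (∑-concatMap (λ r → map (r ∷_) (fillings α k)) (wordsOver k n) f)
                           (∑-cong (wordsOver k n) (λ r → ∑-map (r ∷_) (fillings α k) f))

occ₁≡ : ∀ {r p k} → All Binary r → length r ≡ p + k → occ 2 r ≡ k → occ 1 r ≡ p
occ₁≡ {r} {p} {k} bin len occ₂≡ = +-cancelʳ-≡ k (occ 1 r) p (begin
  occ 1 r + k         ≡⟨ cong (occ 1 r +_) (sym occ₂≡) ⟩
  occ 1 r + occ 2 r   ≡⟨ occ₁+occ₂≡length bin ⟩
  length r            ≡⟨ len ⟩
  p + k               ∎)
  where open ≡-Reasoning

necklace-head≡1 : ∀ {x r} → All Binary (x ∷ r) → IsNecklace (x ∷ r) → 0 < occ 1 (x ∷ r) → x < 2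
necklace-head≡1 {x} {r} bin nec occ>0 = s≤s (necklace-head-minimal nec (occ>0⇒∈ 1 (x ∷ r) occ>0))

-- The first letter of s exceeds that of r, so it is 2, and s being a necklace all its letters are ≥ 2.
top-row≡replicate : ∀ {r s} → 0 < length r → All Binary r → All Binary s →
  Linked _<_ (firstColumn (r ∷ s ∷ [])) → IsNecklace s → s ≡ replicate (length s) 2
top-row≡replicate {s = []}    _ _ _ _ _ = refl
top-row≡replicate {x ∷ _} {y ∷ s} _ ((1≤x , _) ∷ _) s-bin (x<y ∷ [-]) s-nec =
  All≡⇒≡replicate (tabulateAll (λ {z} z∈ →
    ≤-antisym (proj₂ (lookupAll s-bin z∈)) (≤-trans (≤-trans (s≤s 1≤x) x<y) (necklace-head-minimal s-nec z∈))))

occ₁-replicate₂ : ∀ M → occ 1 (replicate M 2) ≡ 0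
occ₁-replicate₂ zero    = refl
occ₁-replicate₂ (suc M) = occ₁-replicate₂ M

occ₂-replicate₂ : ∀ M → occ 2 (replicate M 2) ≡ M
occ₂-replicate₂ zero    = refl
occ₂-replicate₂ (suc M) = cong suc (occ₂-replicate₂ M)

𝟙-oneRowTableau : ∀ p k {r} → r ∈ binaryWords (p + k) →
  𝟙 (isLexTableau? (p + k ∷ []) (p ∷ k ∷ []) (r ∷ [])) ≡ 𝟙 (isNecklace? r) * 𝟙 (occ 2 r ≟ k)
𝟙-oneRowTableau p k {r} r∈ with binaryWords-sound (p + k) r∈
... | len , bin = trans (𝟙-⇔ to from _ (isNecklace? r ×-dec (occ 2 r ≟ k))) (𝟙-× (isNecklace? r) (occ 2 r ≟ k))
  where
  firstColumn-single : ∀ w → Linked _<_ (firstColumn (w ∷ []))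
  firstColumn-single []      = []
  firstColumn-single (_ ∷ _) = [-]
  to : IsLexTableau (p + k ∷ []) (p ∷ k ∷ []) (r ∷ []) → IsNecklace r × occ 2 r ≡ k
  to (_ , _ , (_ ∷ occ₂≡ ∷ []) , _ , (nec ∷ [])) = nec , trans (cong (occ 2) (sym (++-identityʳ r))) occ₂≡
  from : IsNecklace r × occ 2 r ≡ k → IsLexTableau (p + k ∷ []) (p ∷ k ∷ []) (r ∷ [])
  from (nec , occ₂≡) =
    (len ∷ []) , (bin ∷ []) ,
    (trans (cong (occ 1) (++-identityʳ r)) (occ₁≡ bin len occ₂≡) ∷ trans (cong (occ 2) (++-identityʳ r)) occ₂≡ ∷ []) ,
    firstColumn-single r , (nec ∷ [])

firstColumn-increasing : ∀ {r} M → All Binary r → IsNecklace r → 0 < occ 1 r →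
  Linked _<_ (firstColumn (r ∷ replicate M 2 ∷ []))
firstColumn-increasing {_ ∷ _} zero    _   _   _     = [-]
firstColumn-increasing {_ ∷ _} (suc M) bin nec occ>0 = necklace-head≡1 bin nec occ>0 ∷ [-]

𝟙-twoRowTableau : ∀ p k M {r s} → 1 ≤ p → r ∈ binaryWords (p + k) → s ∈ binaryWords M →
  𝟙 (isLexTableau? (p + k ∷ M ∷ []) (p ∷ M + k ∷ []) (r ∷ s ∷ []))
    ≡ 𝟙 (s ≟ʷ replicate M 2) * (𝟙 (isNecklace? r) * 𝟙 (occ 2 r ≟ k))
𝟙-twoRowTableau p k M {r} {s} 1≤p r∈ s∈ with binaryWords-sound (p + k) r∈ | binaryWords-sound M s∈
... | r-len , r-bin | s-len , s-bin = begin
  𝟙 (isLexTableau? (p + k ∷ M ∷ []) (p ∷ M + k ∷ []) (r ∷ s ∷ []))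
    ≡⟨ 𝟙-⇔ to from _ (s ≟ʷ replicate M 2 ×-dec (isNecklace? r ×-dec (occ 2 r ≟ k))) ⟩
  𝟙 (s ≟ʷ replicate M 2 ×-dec (isNecklace? r ×-dec (occ 2 r ≟ k)))
    ≡⟨ 𝟙-× (s ≟ʷ replicate M 2) _ ⟩
  𝟙 (s ≟ʷ replicate M 2) * 𝟙 (isNecklace? r ×-dec (occ 2 r ≟ k))
    ≡⟨ cong (𝟙 (s ≟ʷ replicate M 2) *_) (𝟙-× (isNecklace? r) (occ 2 r ≟ k)) ⟩
  𝟙 (s ≟ʷ replicate M 2) * (𝟙 (isNecklace? r) * 𝟙 (occ 2 r ≟ k)) ∎
  where
  open ≡-Reasoning
  occ-top : ∀ m → occ m (replicate M 2 ++ []) ≡ occ m (replicate M 2)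
  occ-top m = cong (occ m) (++-identityʳ (replicate M 2))
  to : IsLexTableau (p + k ∷ M ∷ []) (p ∷ M + k ∷ []) (r ∷ s ∷ []) → s ≡ replicate M 2 × (IsNecklace r × occ 2 r ≡ k)
  to (_ , _ , (_ ∷ occ₂≡ ∷ []) , linked , (r-nec ∷ s-nec ∷ [])) = s≡ , r-nec , +-cancelʳ-≡ M (occ 2 r) k (begin
    occ 2 r + M                           ≡⟨ cong (occ 2 r +_) (sym (trans (occ-top 2) (occ₂-replicate₂ M))) ⟩
    occ 2 r + occ 2 (replicate M 2 ++ []) ≡⟨ sym (occ-++ 2 r _) ⟩
    occ 2 (r ++ replicate M 2 ++ [])      ≡⟨ cong (λ t → occ 2 (r ++ t ++ [])) (sym s≡) ⟩
    occ 2 (r ++ s ++ [])                  ≡⟨ occ₂≡ ⟩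
    M + k                                 ≡⟨ +-comm M k ⟩
    k + M                                 ∎)
    where
    s≡ : s ≡ replicate M 2
    s≡ = trans (top-row≡replicate (subst (0 <_) (sym r-len) (≤-trans 1≤p (m≤m+n p k))) r-bin s-bin linked s-nec)
               (cong (λ m → replicate m 2) s-len)
  from : s ≡ replicate M 2 × (IsNecklace r × occ 2 r ≡ k) → IsLexTableau (p + k ∷ M ∷ []) (p ∷ M + k ∷ []) (r ∷ s ∷ [])
  from (refl , r-nec , occ₂≡) =
    (r-len ∷ length-replicate M ∷ []) , (r-bin ∷ replicate⁺ M (s≤s z≤n , ≤-refl) ∷ []) , (occ₁ ∷ occ₂ ∷ []) ,
    firstColumn-increasing M r-bin r-nec (subst (0 <_) (sym occ₁r≡p) 1≤p) ,
    (r-nec ∷ replicate-IsNecklace M 2 ∷ [])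
    where
    occ₁r≡p : occ 1 r ≡ p
    occ₁r≡p = occ₁≡ r-bin r-len occ₂≡
    occ₁ : occ 1 (r ++ replicate M 2 ++ []) ≡ p
    occ₁ = trans (occ-++ 1 r _) (trans (cong₂ _+_ occ₁r≡p (trans (occ-top 1) (occ₁-replicate₂ M))) (+-identityʳ p))
    occ₂ : occ 2 (r ++ replicate M 2 ++ []) ≡ M + k
    occ₂ = trans (occ-++ 2 r _) (trans (cong₂ _+_ occ₂≡ (trans (occ-top 2) (occ₂-replicate₂ M))) (+-comm k M))

KL-oneRow : ∀ p k → KL (p + k ∷ []) (p ∷ k ∷ []) ≡ necklaceCount (p + k) k
KL-oneRow p k = begin
  KL (n ∷ []) β                                    ≡⟨ length-filter≡∑𝟙 (isLexTableau? (n ∷ []) β) (fillings (n ∷ []) 2) ⟩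
  ∑ (fillings (n ∷ []) 2) tableau                   ≡⟨ ∑-fillings n [] 2 tableau ⟩
  ∑ (binaryWords n) (λ r → tableau (r ∷ []) + 0)    ≡⟨ ∑-cong-∈ (binaryWords n) (λ r r∈ → trans (+-identityʳ _) (𝟙-oneRowTableau p k r∈)) ⟩
  necklaceCount n k                                ∎
  where
  open ≡-Reasoning
  n = p + k
  β = p ∷ k ∷ []
  tableau : Filling → ℕ
  tableau F = 𝟙 (isLexTableau? (n ∷ []) β F)

-- The top row of such a tableau is forced to be 2 2 … 2.
KL-twoRows : ∀ p k M → 1 ≤ p → KL (p + k ∷ M ∷ []) (p ∷ M + k ∷ []) ≡ necklaceCount (p + k) k
KL-twoRows p k M 1≤p = begin
  KL α β
    ≡⟨ length-filter≡∑𝟙 (isLexTableau? α β) (fillings α 2) ⟩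
  ∑ (fillings α 2) tableau
    ≡⟨ ∑-fillings n (M ∷ []) 2 tableau ⟩
  ∑ (binaryWords n) (λ r → ∑ (fillings (M ∷ []) 2) (λ F → tableau (r ∷ F)))
    ≡⟨ ∑-cong (binaryWords n) (λ r → ∑-fillings M [] 2 (λ F → tableau (r ∷ F))) ⟩
  ∑ (binaryWords n) (λ r → ∑ (binaryWords M) (λ s → tableau (r ∷ s ∷ []) + 0))
    ≡⟨ ∑-cong-∈ (binaryWords n) bottom-row ⟩
  necklaceCount n k ∎
  where
  open ≡-Reasoning
  n = p + k
  α = n ∷ M ∷ []
  β = p ∷ M + k ∷ []
  tableau : Filling → ℕ
  tableau F = 𝟙 (isLexTableau? α β F)
  bottom-row : ∀ r → r ∈ binaryWords n →
    ∑ (binaryWords M) (λ s → tableau (r ∷ s ∷ []) + 0) ≡ 𝟙 (isNecklace? r) * 𝟙 (occ 2 r ≟ k)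
  bottom-row r r∈ = begin
    ∑ (binaryWords M) (λ s → tableau (r ∷ s ∷ []) + 0)
      ≡⟨ ∑-cong-∈ (binaryWords M) (λ s s∈ → trans (+-identityʳ _) (𝟙-twoRowTableau p k M 1≤p r∈ s∈)) ⟩
    ∑ (binaryWords M) (λ s → 𝟙 (s ≟ʷ replicate M 2) * X)
      ≡⟨ ∑-*ʳ (binaryWords M) X (λ s → 𝟙 (s ≟ʷ replicate M 2)) ⟩
    ∑ (binaryWords M) (λ s → 𝟙 (s ≟ʷ replicate M 2)) * X
      ≡⟨ cong (_* X) (∑-𝟙≡-∈ _≟ʷ_ (binaryWords-unique M) replicate∈) ⟩
    1 * X
      ≡⟨ *-identityˡ X ⟩
    X ∎
    where
    X = 𝟙 (isNecklace? r) * 𝟙 (occ 2 r ≟ k)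
    replicate∈ : replicate M 2 ∈ binaryWords M
    replicate∈ = binaryWords-complete (length-replicate M) (replicate⁺ M (s≤s z≤n , ≤-refl))

KL-comp2 : ∀ p k m → 1 ≤ p → 1 ≤ k → KL (comp2 (p + k) m) (comp2 p (m + k)) ≡ necklaceCount (p + k) k
KL-comp2 p (suc k) zero    _   _ = KL-oneRow p (suc k)
KL-comp2 p k       (suc m) 1≤p _ = KL-twoRows p k (suc m) 1≤p

lemma4p14 : (a b i j : ℕ) → 1 ≤ a → 1 ≤ b → 1 ≤ i → i ≤ b → j < i →
    KL (comp2 (a + i) (b ∸ i)) (comp2 (a + j) (b ∸ j)) ≡ T (a + i) (i ∸ j)
lemma4p14 zero        b i j () _ _ _ _
lemma4p14 a@(suc a′) b i j _  _ _ i≤b j<i = begin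
  KL (comp2 (a + i) m) (comp2 p (b ∸ j))   ≡⟨ cong₂ (λ n c → KL (comp2 n m) (comp2 p c)) a+i≡p+k b∸j≡m+k ⟩
  KL (comp2 (p + k) m) (comp2 p (m + k))   ≡⟨ KL-comp2 p k m (s≤s z≤n) (m<n⇒0<n∸m j<i) ⟩
  necklaceCount (p + k) k                  ≡⟨ sym (T≡necklaceCount (a′ + j + k) k) ⟩
  T (p + k) k                              ≡⟨ cong (λ n → T n k) (sym a+i≡p+k) ⟩
  T (a + i) k                              ∎
  where
  open ≡-Reasoning
  p = a + j
  k = i ∸ j
  m = b ∸ i
  a+i≡p+k : a + i ≡ p + k
  a+i≡p+k = trans (cong (a +_) (sym (m+[n∸m]≡n (<⇒≤ j<i)))) (sym (+-assoc a j k))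
  b∸j≡m+k : b ∸ j ≡ m + k
  b∸j≡m+k = trans (cong (_∸ j) (sym (m∸n+n≡m i≤b))) (+-∸-assoc m (<⇒≤ j<i))
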